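{- For every integer $n\ge 4$, the number $v_{n,2}$ of vertices of $G(n)$ that are contained in some $2$-cycle equals $2n+2$.
   Context: For a sequence of distinct integers $c_1\cdots c_t$, $\mathrm{st}(c_1\cdots c_t)$ is the unique permutation $d_1\cdots d_t$ of $\{1,\dots,t\}$ with $d_i<d_j$ iff $c_i<c_j$. $G(n)$ is the directed multigraph whose vertices are the permutations of $\{1,\dots,n\}$ (one-line notation) and whose edges are the permutations $c_1\cdots c_{n+1}$ of $\{1,\dots,n+1\}$, the edge $c_1\cdots c_{n+1}$ going from $\mathrm{st}(c_1\cdots c_n)$ to $\mathrm{st}(c_2\cdots c_{n+1})$; so there is an edge from $x_1\cdots x_n$ to $w_1\cdots w_n$ iff $\mathrm{st}(x_2\cdots x_n)=\mathrm{st}(w_1\cdots w_{n-1})$. A $2$-cycle is a pair of distinct vertices $\mathbf a,\mathbf b$ together with an edge from $\mathbf a$ to $\mathbf b$ and an edge from $\mathbf b$ to $\mathbf a$. -}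

module Defs where

open import Data.Nat using (ℕ; suc; _<_)
open import Data.Fin using (Fin)
open import Data.List using (List; map; upTo)
open import Data.Vec using (Vec; lookup; toList; init; tail)
open import Data.Product using (Σ; _×_)
open import Data.List.Relation.Binary.Permutation.Propositional using (_↭_)
open import Function.Bundles using (_⇔_)
open import Relation.Binary.PropositionalEquality using (_≢_)

IsPerm : (n : ℕ) → Vec ℕ n → Set
IsPerm n v = toList v ↭ map suc (upTo n)

IsSt : {t : ℕ} → Vec ℕ t → Vec ℕ t → Set
IsSt {t} c d = IsPerm t d × (∀ (i j : Fin t) → (lookup d i < lookup d j) ⇔ (lookup c i < lookup c j))

-- An edge of G(n) from a to b: a permutation c = c_1⋯c_{n+1} of {1,…,n+1}
-- with st(c_1⋯c_n) = a and st(c_2⋯c_{n+1}) = b.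
Edge : (n : ℕ) → Vec ℕ n → Vec ℕ n → Set
Edge n a b = Σ (Vec ℕ (suc n)) λ c → IsPerm (suc n) c × IsSt (init c) a × IsSt (tail c) b

InTwoCycle : (n : ℕ) → Vec ℕ n → Set
InTwoCycle n a = Σ (Vec ℕ n) λ b → IsPerm n b × a ≢ b × Edge n a b × Edge n b a

module Submission where

-- If a → b → a, the two edges force positions i+2, j+2 of a to compare
-- like i, j: the order pattern of a is 2-periodic.  Conversely, a key
-- k : ℕ → ℕ that is 2-periodic on n + 2 positions and zigzags at its start
-- gives the 2-cycle st(k₀ ⋯ kₙ₋₁) → st(k₁ ⋯ kₙ) → st(k₂ ⋯ kₙ₊₁) = st(k₀ ⋯ kₙ₋₁),
-- st being standardisation, while a monotone pattern only admits a = b.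
-- It remains to classify the 2-periodic patterns of length n ≥ 4.  When
-- the entries at even positions increase, either those at odd positions
-- increase as well and the pattern is fixed by how the two sequences
-- interleave (a parameter u < n), or they decrease and lie entirely above
-- or entirely below the evens; otherwise the value-reversed pattern is of
-- this kind.  These 2(n + 2) patterns are distinct, each is realised by an
-- explicit key, and all but the identity and its reversal lie on 2-cycles.

open import Defs
open import Data.Nat
open import Data.Nat.Properties
open import Data.Nat.Tactic.RingSolver using (solve-∀)
open import Data.Fin using (Fin; toℕ; fromℕ<) renaming (zero to fzero; suc to fsuc)
open import Data.Fin.Properties using (toℕ<n; toℕ-fromℕ<)
open import Data.List using (List; []; _∷_; map; upTo; applyUpTo; length; _++_)
open import Data.List.Properties using (map-applyUpTo; length-map; length-++)
open import Data.List.Relation.Unary.All as All using (All; []; _∷_)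
import Data.List.Relation.Unary.All.Properties as AllProps
open import Data.List.Relation.Unary.Any using (here; there)
open import Data.List.Relation.Unary.Linked using (Linked)
open import Data.List.Relation.Unary.AllPairs as AllPairs using (AllPairs; []; _∷_)
open import Data.List.Relation.Unary.Linked.Properties using (Linked⇒AllPairs)
open import Data.List.Relation.Unary.Unique.Propositional using (Unique)
import Data.List.Relation.Unary.Unique.Propositional.Properties as Unique
open import Data.List.Membership.Propositional using (_∈_)
open import Data.List.Membership.Propositional.Properties using (∈-map⁺; ∈-map⁻; ∈-++⁺ˡ; ∈-++⁺ʳ; ∈-++⁻)
open import Data.List.Relation.Binary.Permutation.Propositional using (_↭_; ↭-sym; ↭-trans; ↭⇒↭ₛ) renaming (refl to ↭-refl; prep to ↭-prep; swap to ↭-swap; trans to ↭-trans′)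
open import Data.List.Relation.Binary.Permutation.Propositional.Properties using (∈-resp-↭; ↭-length; All-resp-↭)
import Data.List.Relation.Binary.Permutation.Setoid.Properties as PermutationSetoid
open import Data.List.Sort ≤-decTotalOrder using (sort; sort-↭; sort-↗)
open import Data.Vec using (Vec; []; _∷_; lookup; toList; init; tail)
open import Data.Product using (Σ; _×_; _,_; proj₁; proj₂)
open import Data.Sum using (_⊎_; inj₁; inj₂)
open import Data.Unit using (⊤; tt)
open import Data.Empty using (⊥; ⊥-elim)
open import Relation.Nullary using (¬_; Dec; yes; no)
open import Relation.Binary.Definitions using (tri<; tri≈; tri>)
open import Relation.Binary.PropositionalEquality
open import Function.Base using (_∘′_)
open import Function.Bundles using (_⇔_; mk⇔; module Equivalence)
open import Function.Properties.Equivalence using () renaming (refl to ⇔-refl; sym to ⇔-sym; trans to infixr 5 _⟫_)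
open Equivalence using (to; from)

both-true : ∀ {A B : Set} → A → B → (A ⇔ B)
both-true a b = mk⇔ (λ _ → b) (λ _ → a)

both-false : ∀ {A B : Set} → ¬ A → ¬ B → (A ⇔ B)
both-false ¬a ¬b = mk⇔ (λ a → ⊥-elim (¬a a)) (λ b → ⊥-elim (¬b b))

4≤⇒0< : ∀ {n} → 4 ≤ n → 0 < n
4≤⇒0< 4≤n = <-≤-trans (s≤s z≤n) 4≤n

4≤⇒1< : ∀ {n} → 4 ≤ n → 1 < n
4≤⇒1< 4≤n = <-≤-trans (s≤s (s≤s z≤n)) 4≤n

4≤⇒2< : ∀ {n} → 4 ≤ n → 2 < n
4≤⇒2< 4≤n = <-≤-trans (s≤s (s≤s (s≤s z≤n))) 4≤n

range : ℕ → ℕ → List ℕ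
range b zero = []
range b (suc m) = b ∷ range (suc b) m

applyUpTo-range : ∀ (f : ℕ → ℕ) b m → (∀ i → f i ≡ b + i) → applyUpTo f m ≡ range b m
applyUpTo-range f b zero _ = refl
applyUpTo-range f b (suc m) f≗b+ = cong₂ _∷_ (trans (f≗b+ 0) (+-identityʳ b))
  (applyUpTo-range (λ i → f (suc i)) (suc b) m (λ i → trans (f≗b+ (suc i)) (+-suc b i)))

suc-upTo≡range : ∀ n → map suc (upTo n) ≡ range 1 n
suc-upTo≡range n = trans (map-applyUpTo (λ i → i) suc n) (applyUpTo-range suc 1 n (λ _ → refl))

map-range-suc : ∀ (f : ℕ → ℕ) m b → map f (range (suc b) m) ≡ map (λ i → f (suc i)) (range b m)
map-range-suc f zero b = refl
map-range-suc f (suc m) b = cong (f (suc b) ∷_) (map-range-suc f m (suc b))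

length-range : ∀ b m → length (range b m) ≡ m
length-range b zero = refl
length-range b (suc m) = cong suc (length-range (suc b) m)

∈-range⁻ : ∀ {x} b m → x ∈ range b m → b ≤ x × x < b + m
∈-range⁻ b (suc m) (here refl) = ≤-refl , subst (b <_) (sym (+-suc b m)) (s≤s (m≤m+n b m))
∈-range⁻ {x} b (suc m) (there x∈) with ∈-range⁻ (suc b) m x∈
... | b<x , x<b+m = <⇒≤ b<x , subst (x <_) (sym (+-suc b m)) x<b+m

∈-range⁺ : ∀ {x} b m → b ≤ x → x < b + m → x ∈ range b m
∈-range⁺ {x} b zero b≤x x<b = ⊥-elim (<-irrefl refl (≤-trans x<b (subst (_≤ x) (sym (+-identityʳ b)) b≤x)))
∈-range⁺ {x} b (suc m) b≤x x<b+m with b ≟ x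
... | yes refl = here refl
... | no b≢x = there (∈-range⁺ (suc b) m (≤∧≢⇒< b≤x b≢x) (subst (x <_) (+-suc b m) x<b+m))

range-unique : ∀ b m → Unique (range b m)
range-unique b zero = []
range-unique b (suc m) = All.map (λ x∈ → <⇒≢ (proj₁ (∈-range⁻ (suc b) m x∈))) (All.tabulate (λ x∈ → x∈))
  ∷ range-unique (suc b) m

-- at v i is the i-th entry of v (and 0 out of range); it lets us reason
-- about positions as natural numbers, where shifting by 2 is easy.
at : ∀ {n} → Vec ℕ n → ℕ → ℕ
at [] i = 0
at (x ∷ v) zero = x
at (x ∷ v) (suc i) = at v i

lookup≡at : ∀ {n} (v : Vec ℕ n) (i : Fin n) → lookup v i ≡ at v (toℕ i)
lookup≡at (x ∷ v) fzero = refl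
lookup≡at (x ∷ v) (fsuc i) = lookup≡at v i

at-tail : ∀ {n} (v : Vec ℕ (suc n)) i → at (tail v) i ≡ at v (suc i)
at-tail (x ∷ v) i = refl

at-init : ∀ {n} (v : Vec ℕ (suc n)) i → i < n → at (init v) i ≡ at v i
at-init {suc n} (x ∷ y ∷ v) zero _ = refl
at-init {suc n} (x ∷ y ∷ v) (suc i) (s≤s i<n) = at-init (y ∷ v) i i<n

toList≡map-at : ∀ {n} (v : Vec ℕ n) → toList v ≡ map (at v) (range 0 n)
toList≡map-at [] = refl
toList≡map-at {suc n} (x ∷ v) = cong (x ∷_) (trans (toList≡map-at v) (sym (map-range-suc (at (x ∷ v)) n 0)))

at-ext : ∀ {n} (v w : Vec ℕ n) → (∀ i → i < n → at v i ≡ at w i) → v ≡ w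
at-ext [] [] _ = refl
at-ext (x ∷ v) (y ∷ w) v≗w = cong₂ _∷_ (v≗w 0 (s≤s z≤n)) (at-ext v w (λ i i<n → v≗w (suc i) (s≤s i<n)))

at-∈ : ∀ {n} (v : Vec ℕ n) i → i < n → at v i ∈ toList v
at-∈ (x ∷ v) zero _ = here refl
at-∈ (x ∷ v) (suc i) (s≤s i<n) = there (at-∈ v i i<n)

tabulateℕ : (n : ℕ) → (ℕ → ℕ) → Vec ℕ n
tabulateℕ zero f = []
tabulateℕ (suc n) f = f 0 ∷ tabulateℕ n (λ i → f (suc i))

at-tabulateℕ : ∀ n f i → i < n → at (tabulateℕ n f) i ≡ f i
at-tabulateℕ (suc n) f zero _ = refl
at-tabulateℕ (suc n) f (suc i) (s≤s i<n) = at-tabulateℕ n (λ j → f (suc j)) i i<n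

toList-tabulateℕ : ∀ n f → toList (tabulateℕ n f) ≡ map f (range 0 n)
toList-tabulateℕ zero f = refl
toList-tabulateℕ (suc n) f = cong (f 0 ∷_) (trans (toList-tabulateℕ n (λ i → f (suc i))) (sym (map-range-suc f n 0)))

SameOrder : ℕ → (ℕ → ℕ) → (ℕ → ℕ) → Set
SameOrder n f g = ∀ i j → i < n → j < n → (f i < f j ⇔ g i < g j)

sameOrder-sym : ∀ {n f g} → SameOrder n f g → SameOrder n g f
sameOrder-sym f~g i j i<n j<n = ⇔-sym (f~g i j i<n j<n)

sameOrder-trans : ∀ {n f g h} → SameOrder n f g → SameOrder n g h → SameOrder n f h
sameOrder-trans f~g g~h i j i<n j<n = f~g i j i<n j<n ⟫ g~h i j i<n j<n

InjectiveOn : ℕ → (ℕ → ℕ) → Set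
InjectiveOn n f = ∀ i j → i < n → j < n → f i ≡ f j → i ≡ j

injectiveOn-≤ : ∀ {m m'} k → m' ≤ m → InjectiveOn m k → InjectiveOn m' k
injectiveOn-≤ k m'≤m inj i j i<m' j<m' = inj i j (≤-trans i<m' m'≤m) (≤-trans j<m' m'≤m)

injectiveOn-suc : ∀ {m} k → InjectiveOn (suc m) k → InjectiveOn m (λ i → k (suc i))
injectiveOn-suc k inj i j i<m j<m kᵢ₊₁≡kⱼ₊₁ = suc-injective (inj (suc i) (suc j) (s≤s i<m) (s≤s j<m) kᵢ₊₁≡kⱼ₊₁)

isBelow : ℕ → ℕ → ℕ
isBelow z x with z <? x
... | yes _ = 1
... | no _ = 0

isBelow-yes : ∀ {z x} → z < x → isBelow z x ≡ 1
isBelow-yes {z} {x} z<x with z <? x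
... | yes _ = refl
... | no z≮x = ⊥-elim (z≮x z<x)

isBelow-no : ∀ {z x} → ¬ z < x → isBelow z x ≡ 0
isBelow-no {z} {x} z≮x with z <? x
... | yes z<x = ⊥-elim (z≮x z<x)
... | no _ = refl

isBelow≤1 : ∀ z x → isBelow z x ≤ 1
isBelow≤1 z x with z <? x
... | yes _ = ≤-refl
... | no _ = z≤n

isBelow-mono : ∀ z {x y} → x ≤ y → isBelow z x ≤ isBelow z y
isBelow-mono z {x} {y} x≤y with z <? x | z <? y
... | yes _ | yes _ = ≤-refl
... | no _ | _ = z≤n
... | yes z<x | no z≮y = ⊥-elim (z≮y (<-≤-trans z<x x≤y))

isBelow-cong : ∀ {a b c d} → (a < b ⇔ c < d) → isBelow a b ≡ isBelow c d
isBelow-cong {a} {b} {c} {d} a<b⇔c<d with a <? b | c <? d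
... | yes _ | yes _ = refl
... | no _ | no _ = refl
... | yes a<b | no c≮d = ⊥-elim (c≮d (to a<b⇔c<d a<b))
... | no a≮b | yes c<d = ⊥-elim (a≮b (from a<b⇔c<d c<d))

below : List ℕ → ℕ → ℕ
below [] x = 0
below (z ∷ zs) x = isBelow z x + below zs x

below-↭ : ∀ {xs ys} x → xs ↭ ys → below xs x ≡ below ys x
below-↭ x ↭-refl = refl
below-↭ x (↭-prep z p) = cong (isBelow z x +_) (below-↭ x p)
below-↭ x (↭-swap y z p) = begin
  isBelow y x + (isBelow z x + _) ≡⟨ sym (+-assoc (isBelow y x) (isBelow z x) _) ⟩
  (isBelow y x + isBelow z x) + _ ≡⟨ cong₂ _+_ (+-comm (isBelow y x) (isBelow z x)) (below-↭ x p) ⟩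
  (isBelow z x + isBelow y x) + _ ≡⟨ +-assoc (isBelow z x) (isBelow y x) _ ⟩
  isBelow z x + (isBelow y x + _) ∎
  where open ≡-Reasoning
below-↭ x (↭-trans′ p q) = trans (below-↭ x p) (below-↭ x q)

below-mono : ∀ L {x y} → x ≤ y → below L x ≤ below L y
below-mono [] _ = z≤n
below-mono (z ∷ L) x≤y = +-mono-≤ (isBelow-mono z x≤y) (below-mono L x≤y)

below-strict : ∀ L {z x y} → z ∈ L → x ≤ z → z < y → below L x < below L y
below-strict (z ∷ L) {x = x} (here refl) x≤z z<y rewrite isBelow-no {z} {x} (≤⇒≯ x≤z) | isBelow-yes z<y =
  s≤s (below-mono L (≤-trans x≤z (<⇒≤ z<y)))
below-strict (w ∷ L) (there z∈) x≤z z<y =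
  +-mono-≤-< (isBelow-mono w (≤-trans x≤z (<⇒≤ z<y))) (below-strict L z∈ x≤z z<y)

below≤length : ∀ L x → below L x ≤ length L
below≤length [] x = z≤n
below≤length (z ∷ L) x = +-mono-≤ (isBelow≤1 z x) (below≤length L x)

below<length : ∀ L {z x} → z ∈ L → ¬ z < x → below L x < length L
below<length (z ∷ L) {x = x} (here refl) z≮x rewrite isBelow-no {z} {x} z≮x = s≤s (below≤length L x)
below<length (w ∷ L) (there z∈) z≮x = +-mono-≤-< (isBelow≤1 w _) (below<length L z∈ z≮x)

below-cong : ∀ (f g : ℕ → ℕ) x y L → (∀ j → j ∈ L → (f j < x ⇔ g j < y)) → below (map f L) x ≡ below (map g L) y
below-cong f g x y [] _ = refl
below-cong f g x y (j ∷ L) f⇔g =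
  cong₂ _+_ (isBelow-cong (f⇔g j (here refl))) (below-cong f g x y L (λ j' j'∈ → f⇔g j' (there j'∈)))

below-range-low : ∀ m b x → x ≤ b → below (range b m) x ≡ 0
below-range-low zero b x _ = refl
below-range-low (suc m) b x x≤b rewrite isBelow-no {b} {x} (≤⇒≯ x≤b) = below-range-low m (suc b) x (m≤n⇒m≤1+n x≤b)

below-range : ∀ m b x → b ≤ x → x ≤ b + m → below (range b m) x + b ≡ x
below-range zero b x b≤x x≤b = ≤-antisym b≤x (subst (x ≤_) (+-identityʳ b) x≤b)
below-range (suc m) b x b≤x x≤b+m with b <? x
... | yes b<x = trans (sym (+-suc _ b)) (below-range m (suc b) x b<x (subst (x ≤_) (+-suc b m) x≤b+m))
... | no b≮x with ≤-antisym b≤x (≮⇒≥ b≮x)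
... | refl = cong (_+ b) (below-range-low m (suc b) b (n≤1+n b))

perm→range : ∀ {n} {v : Vec ℕ n} → IsPerm n v → toList v ↭ range 1 n
perm→range {n} {v} = subst (toList v ↭_) (suc-upTo≡range n)

range→perm : ∀ {n} {v : Vec ℕ n} → toList v ↭ range 1 n → IsPerm n v
range→perm {n} {v} = subst (toList v ↭_) (sym (suc-upTo≡range n))

perm-bounded : ∀ {n} {v : Vec ℕ n} → IsPerm n v → ∀ i → i < n → 1 ≤ at v i × at v i ≤ n
perm-bounded {n} {v} v-perm i i<n with ∈-range⁻ 1 n (∈-resp-↭ (perm→range v-perm) (at-∈ v i i<n))
... | 1≤vᵢ , s≤s vᵢ≤n = 1≤vᵢ , vᵢ≤n

-- Every entry of a permutation equals one plus the number of entries
-- below it, so a permutation is recovered from its order pattern.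
perm-entry≡rank : ∀ {n} {v : Vec ℕ n} → IsPerm n v → ∀ i → i < n → below (toList v) (at v i) + 1 ≡ at v i
perm-entry≡rank {n} {v} v-perm i i<n with perm-bounded v-perm i i<n
... | 1≤vᵢ , vᵢ≤n =
  trans (cong (_+ 1) (below-↭ (at v i) (perm→range v-perm))) (below-range n 1 (at v i) 1≤vᵢ (m≤n⇒m≤1+n vᵢ≤n))

perm-unique : ∀ {n} (v w : Vec ℕ n) → IsPerm n v → IsPerm n w → SameOrder n (at v) (at w) → v ≡ w
perm-unique {n} v w v-perm w-perm v~w = at-ext v w λ i i<n → begin
  at v i                                        ≡⟨ sym (perm-entry≡rank v-perm i i<n) ⟩
  below (toList v) (at v i) + 1                  ≡⟨ cong (λ L → below L (at v i) + 1) (toList≡map-at v) ⟩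
  below (map (at v) (range 0 n)) (at v i) + 1    ≡⟨ cong (_+ 1) (below-cong (at v) (at w) (at v i) (at w i) (range 0 n)
                                                      (λ j j∈ → v~w j i (proj₂ (∈-range⁻ 0 n j∈)) i<n)) ⟩
  below (map (at w) (range 0 n)) (at w i) + 1    ≡⟨ cong (λ L → below L (at w i) + 1) (sym (toList≡map-at w)) ⟩
  below (toList w) (at w i) + 1                  ≡⟨ perm-entry≡rank w-perm i i<n ⟩
  at w i                                        ∎
  where open ≡-Reasoning

unique-↭ : ∀ {xs ys : List ℕ} → xs ↭ ys → Unique xs → Unique ys
unique-↭ p = PermutationSetoid.Unique-resp-↭ (setoid ℕ) (↭⇒↭ₛ p)

map-unique : ∀ {A B : Set} (g : A → B) {L} → (∀ {x y} → x ∈ L → y ∈ L → g x ≡ g y → x ≡ y) →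
  Unique L → Unique (map g L)
map-unique g inj [] = []
map-unique g inj (x∉L ∷ L-unique) =
  AllProps.map⁺ (All.tabulate λ y∈L gx≡gy → All.lookup x∉L y∈L (inj (here refl) (there y∈L) gx≡gy))
  ∷ map-unique g (λ x∈ y∈ → inj (there x∈) (there y∈)) L-unique

unique-injective : ∀ {n} (v : Vec ℕ n) → Unique (toList v) → InjectiveOn n (at v)
unique-injective (x ∷ v) _ zero zero _ _ _ = refl
unique-injective (x ∷ v) (x∉ ∷ _) zero (suc j) _ (s≤s j<n) x≡vⱼ = ⊥-elim (All.lookup x∉ (at-∈ v j j<n) x≡vⱼ)
unique-injective (x ∷ v) (x∉ ∷ _) (suc i) zero (s≤s i<n) _ vᵢ≡x = ⊥-elim (All.lookup x∉ (at-∈ v i i<n) (sym vᵢ≡x))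
unique-injective (x ∷ v) (_ ∷ v-unique) (suc i) (suc j) (s≤s i<n) (s≤s j<n) vᵢ≡vⱼ =
  cong suc (unique-injective v v-unique i j i<n j<n vᵢ≡vⱼ)

perm-injective : ∀ {n} {v : Vec ℕ n} → IsPerm n v → InjectiveOn n (at v)
perm-injective {n} {v} v-perm = unique-injective v (unique-↭ (↭-sym (perm→range v-perm)) (range-unique 1 n))

sorted-unique⇒increasing : ∀ {xs} → Linked _≤_ xs → Unique xs → AllPairs _<_ xs
sorted-unique⇒increasing sorted unique =
  AllPairs.zipWith (λ (x≤y , x≢y) → ≤∧≢⇒< x≤y x≢y) (Linked⇒AllPairs ≤-trans sorted , unique)

increasing-length : ∀ {xs} lo hi → lo ≤ hi → AllPairs _<_ xs → All (lo ≤_) xs → All (_< hi) xs → length xs + lo ≤ hi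
increasing-length {[]} lo hi lo≤hi _ _ _ = lo≤hi
increasing-length {x ∷ xs} lo hi _ (x<xs ∷ increasing) (lo≤x ∷ _) (x<hi ∷ xs<hi) = begin
  suc (length xs + lo) ≡⟨ sym (+-suc (length xs) lo) ⟩
  length xs + suc lo   ≤⟨ +-monoʳ-≤ (length xs) (s≤s lo≤x) ⟩
  length xs + suc x    ≤⟨ increasing-length (suc x) hi x<hi increasing x<xs xs<hi ⟩
  hi                   ∎
  where open ≤-Reasoning

increasing≡range : ∀ {xs} b m → AllPairs _<_ xs → All (b ≤_) xs → All (_< b + m) xs → length xs ≡ m → xs ≡ range b m
increasing≡range {[]} b zero _ _ _ _ = refl
increasing≡range {x ∷ xs} b (suc m) (x<xs ∷ increasing) (b≤x ∷ _) (x<b+m ∷ xs<b+m) len≡ with b ≟ x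
... | yes refl = cong (b ∷_)
  (increasing≡range (suc b) m increasing x<xs (subst (λ t → All (_< t) xs) (+-suc b m) xs<b+m) (suc-injective len≡))
... | no b≢x = ⊥-elim (<⇒≱ (≤∧≢⇒< b≤x b≢x) (s≤s⁻¹ (+-cancelˡ-≤ m (suc x) (suc b) bound)))
  where
  bound : m + suc x ≤ m + suc b
  bound = begin
    m + suc x          ≡⟨ cong (_+ suc x) (sym (suc-injective len≡)) ⟩
    length xs + suc x  ≤⟨ increasing-length (suc x) (b + suc m) x<b+m increasing x<xs xs<b+m ⟩
    b + suc m          ≡⟨ trans (+-comm b (suc m)) (sym (+-suc m b)) ⟩
    m + suc b          ∎
    where open ≤-Reasoning

rank : (ℕ → ℕ) → ℕ → ℕ → ℕ
rank k n i = suc (below (map k (range 0 n)) (k i))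

st : (ℕ → ℕ) → (n : ℕ) → Vec ℕ n
st k n = tabulateℕ n (rank k n)

rank-sameOrder : ∀ k n → SameOrder n (rank k n) k
rank-sameOrder k n i j i<n j<n = mk⇔ rank⇒key (key⇒rank i j i<n)
  where
  keys = map k (range 0 n)
  key∈ : ∀ i → i < n → k i ∈ keys
  key∈ i i<n = ∈-map⁺ k (∈-range⁺ 0 n z≤n i<n)
  key⇒rank : ∀ i j → i < n → k i < k j → rank k n i < rank k n j
  key⇒rank i j i<n kᵢ<kⱼ = s≤s (below-strict keys (key∈ i i<n) ≤-refl kᵢ<kⱼ)
  rank⇒key : rank k n i < rank k n j → k i < k j
  rank⇒key rᵢ<rⱼ with <-cmp (k i) (k j)
  ... | tri< kᵢ<kⱼ _ _ = kᵢ<kⱼ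
  ... | tri≈ _ kᵢ≡kⱼ _ = ⊥-elim (<-irrefl (cong (λ x → suc (below keys x)) kᵢ≡kⱼ) rᵢ<rⱼ)
  ... | tri> _ _ kⱼ<kᵢ = ⊥-elim (<-asym rᵢ<rⱼ (key⇒rank j i j<n kⱼ<kᵢ))

st-sameOrder : ∀ k n → SameOrder n (at (st k n)) k
st-sameOrder k n i j i<n j<n rewrite at-tabulateℕ n (rank k n) i i<n | at-tabulateℕ n (rank k n) j j<n =
  rank-sameOrder k n i j i<n j<n

rank-injective : ∀ k n → InjectiveOn n k → InjectiveOn n (rank k n)
rank-injective k n inj i j i<n j<n rᵢ≡rⱼ with <-cmp (k i) (k j)
... | tri< kᵢ<kⱼ _ _ = ⊥-elim (<-irrefl rᵢ≡rⱼ (from (rank-sameOrder k n i j i<n j<n) kᵢ<kⱼ))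
... | tri≈ _ kᵢ≡kⱼ _ = inj i j i<n j<n kᵢ≡kⱼ
... | tri> _ _ kⱼ<kᵢ = ⊥-elim (<-irrefl (sym rᵢ≡rⱼ) (from (rank-sameOrder k n j i j<n i<n) kⱼ<kᵢ))

rank-bounded : ∀ k n i → i < n → 1 ≤ rank k n i × rank k n i < 1 + n
rank-bounded k n i i<n = s≤s z≤n , s≤s (subst (below keys (k i) <_) (trans (length-map k (range 0 n)) (length-range 0 n))
  (below<length keys (∈-map⁺ k (∈-range⁺ 0 n z≤n i<n)) (<-irrefl refl)))
  where keys = map k (range 0 n)

-- The ranks of an injective key are n distinct numbers in [1, n], so
-- sorting them gives range 1 n: st k n is a permutation.
st-isPerm : ∀ k n → InjectiveOn n k → IsPerm n (st k n)
st-isPerm k n inj = range→perm (subst (_↭ range 1 n) (sym (toList-tabulateℕ n (rank k n)))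
  (↭-trans (↭-sym (sort-↭ ranks)) (subst (sort ranks ↭_) sorted≡range ↭-refl)))
  where
  ranks = map (rank k n) (range 0 n)
  ranks-unique : Unique ranks
  ranks-unique = map-unique (rank k n)
    (λ i∈ j∈ → rank-injective k n inj _ _ (proj₂ (∈-range⁻ 0 n i∈)) (proj₂ (∈-range⁻ 0 n j∈))) (range-unique 0 n)
  all-sorted : ∀ P → (∀ i → i < n → P (rank k n i)) → All P (sort ranks)
  all-sorted P P-rank = All-resp-↭ (↭-sym (sort-↭ ranks))
    (AllProps.map⁺ (All.tabulate λ i∈ → P-rank _ (proj₂ (∈-range⁻ 0 n i∈))))
  sorted≡range : sort ranks ≡ range 1 n
  sorted≡range = increasing≡range 1 n
    (sorted-unique⇒increasing (sort-↗ ranks) (unique-↭ (↭-sym (sort-↭ ranks)) ranks-unique))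
    (all-sorted (1 ≤_) (λ i i<n → proj₁ (rank-bounded k n i i<n)))
    (all-sorted (_< 1 + n) (λ i i<n → proj₂ (rank-bounded k n i i<n)))
    (trans (↭-length (sort-↭ ranks)) (trans (length-map (rank k n) (range 0 n)) (length-range 0 n)))

st-cong : ∀ {n k k'} → SameOrder n k k' → st k n ≡ st k' n
st-cong {n} {k} {k'} k~k' = at-ext (st k n) (st k' n) λ i i<n → begin
  at (st k n) i                          ≡⟨ at-tabulateℕ n (rank k n) i i<n ⟩
  suc (below (map k (range 0 n)) (k i))   ≡⟨ cong suc (below-cong k k' (k i) (k' i) (range 0 n)
                                              (λ j j∈ → k~k' j i (proj₂ (∈-range⁻ 0 n j∈)) i<n)) ⟩
  suc (below (map k' (range 0 n)) (k' i)) ≡⟨ sym (at-tabulateℕ n (rank k' n) i i<n) ⟩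
  at (st k' n) i                         ∎
  where open ≡-Reasoning

-- The graph G(n): edges shift order patterns by one position, so 2-cycles
-- are 2-periodic, and 2-periodic zigzagging keys produce 2-cycles.

isSt⇒sameOrder : ∀ {n} {c d : Vec ℕ n} → IsSt c d → SameOrder n (at d) (at c)
isSt⇒sameOrder {n} {c} {d} (_ , d~c) i j i<n j<n =
  subst₂ (λ x y → (at d x < at d y ⇔ at c x < at c y)) (toℕ-fromℕ< i<n) (toℕ-fromℕ< j<n)
    (subst₂ _⇔_ (cong₂ _<_ (lookup≡at d (fromℕ< i<n)) (lookup≡at d (fromℕ< j<n)))
                (cong₂ _<_ (lookup≡at c (fromℕ< i<n)) (lookup≡at c (fromℕ< j<n)))
                (d~c (fromℕ< i<n) (fromℕ< j<n)))

sameOrder⇒isSt : ∀ {n} {c d : Vec ℕ n} → IsPerm n d → SameOrder n (at d) (at c) → IsSt c d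
sameOrder⇒isSt {n} {c} {d} d-perm d~c = d-perm , λ i j →
  subst₂ _⇔_ (sym (cong₂ _<_ (lookup≡at d i) (lookup≡at d j))) (sym (cong₂ _<_ (lookup≡at c i) (lookup≡at c j)))
    (d~c (toℕ i) (toℕ j) (toℕ<n i) (toℕ<n j))

sameOrder-init : ∀ {n} (v : Vec ℕ (suc n)) f → SameOrder (suc n) (at v) f → SameOrder n (at (init v)) f
sameOrder-init {n} v f v~f i j i<n j<n rewrite at-init v i i<n | at-init v j j<n =
  v~f i j (m<n⇒m<1+n i<n) (m<n⇒m<1+n j<n)

sameOrder-tail : ∀ {n} (v : Vec ℕ (suc n)) f → SameOrder (suc n) (at v) f → SameOrder n (at (tail v)) (λ i → f (suc i))
sameOrder-tail v f v~f i j i<n j<n rewrite at-tail v i | at-tail v j = v~f (suc i) (suc j) (s≤s i<n) (s≤s j<n)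

edge-shift : ∀ {n a b} → Edge n a b → ∀ i j → suc i < n → suc j < n →
  (at a (suc i) < at a (suc j) ⇔ at b i < at b j)
edge-shift {n} {a} {b} (c , _ , a=st , b=st) i j 1+i<n 1+j<n =
  isSt⇒sameOrder {c = init c} a=st (suc i) (suc j) 1+i<n 1+j<n
  ⟫ subst₂ (λ x y → (x < y ⇔ at c (suc i) < at c (suc j))) (sym (at-init c (suc i) 1+i<n)) (sym (at-init c (suc j) 1+j<n)) ⇔-refl
  ⟫ subst₂ (λ x y → (at c (suc i) < at c (suc j) ⇔ x < y)) (sym (at-tail c i)) (sym (at-tail c j)) ⇔-refl
  ⟫ ⇔-sym (isSt⇒sameOrder {c = tail c} b=st i j (<-trans (n<1+n i) 1+i<n) (<-trans (n<1+n j) 1+j<n))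

TwoPeriodic : ℕ → (ℕ → ℕ) → Set
TwoPeriodic n f = ∀ i j → 2 + i < n → 2 + j < n → (f i < f j ⇔ f (2 + i) < f (2 + j))

twoPeriodic-≤ : ∀ {m m' k} → m' ≤ m → TwoPeriodic m k → TwoPeriodic m' k
twoPeriodic-≤ m'≤m k-per i j 2+i<m' 2+j<m' = k-per i j (≤-trans 2+i<m' m'≤m) (≤-trans 2+j<m' m'≤m)

twoCycle-periodic : ∀ {n a b} → Edge n a b → Edge n b a → TwoPeriodic n (at a)
twoCycle-periodic a→b b→a i j 2+i<n 2+j<n =
  ⇔-sym (edge-shift b→a i j (<-trans (n<1+n _) 2+i<n) (<-trans (n<1+n _) 2+j<n))
  ⟫ ⇔-sym (edge-shift a→b (suc i) (suc j) 2+i<n 2+j<n)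

st-edge : ∀ n k → InjectiveOn (suc n) k → Edge n (st k n) (st (λ i → k (suc i)) n)
st-edge n k inj = st k (suc n) , st-isPerm k (suc n) inj ,
  sameOrder⇒isSt {c = init (st k (suc n))} (st-isPerm k n (injectiveOn-≤ k (n≤1+n n) inj))
    (sameOrder-trans (st-sameOrder k n) (sameOrder-sym (sameOrder-init (st k (suc n)) k (st-sameOrder k (suc n))))) ,
  sameOrder⇒isSt {c = tail (st k (suc n))} (st-isPerm k' n (injectiveOn-suc k inj))
    (sameOrder-trans (st-sameOrder k' n) (sameOrder-sym (sameOrder-tail (st k (suc n)) k (st-sameOrder k (suc n)))))
  where k' = λ i → k (suc i)

Zigzag : (ℕ → ℕ) → Set
Zigzag k = (k 0 < k 1 × k 2 < k 1) ⊎ (k 1 < k 0 × k 1 < k 2)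

zigzag-shift-differs : ∀ {k} → Zigzag k → ¬ (k 0 < k 1 ⇔ k 1 < k 2)
zigzag-shift-differs (inj₁ (k₀<k₁ , k₂<k₁)) k₀₁⇔k₁₂ = <-asym k₂<k₁ (to k₀₁⇔k₁₂ k₀<k₁)
zigzag-shift-differs (inj₂ (k₁<k₀ , k₁<k₂)) k₀₁⇔k₁₂ = <-asym k₁<k₀ (from k₀₁⇔k₁₂ k₁<k₂)

-- An injective key, 2-periodic on n + 2 positions and zigzagging at the
-- start, gives the 2-cycle st k n → st (k ∘ suc) n → st (k ∘ suc ∘ suc) n
-- = st k n; the zigzag makes the two vertices different.
twoCycle-of-key : ∀ n k → 2 ≤ n → InjectiveOn (2 + n) k → TwoPeriodic (2 + n) k → Zigzag k → InTwoCycle n (st k n)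
twoCycle-of-key n k 2≤n inj k-per zig =
  st k' n , st-isPerm k' n (injectiveOn-≤ k' (n≤1+n n) inj') , a≢b , st-edge n k (injectiveOn-≤ k (n≤1+n (suc n)) inj) ,
  subst (Edge n (st k' n)) (st-cong k₂~k) (st-edge n k' inj')
  where
  k' = λ i → k (suc i)
  inj' : InjectiveOn (suc n) k'
  inj' = injectiveOn-suc k inj
  k₂~k : SameOrder n (λ i → k (2 + i)) k
  k₂~k i j i<n j<n = ⇔-sym (k-per i j (s≤s (s≤s i<n)) (s≤s (s≤s j<n)))
  a≢b : st k n ≢ st k' n
  a≢b a≡b = zigzag-shift-differs {k} zig (⇔-sym (st-sameOrder k n 0 1 0<n 1<n)
    ⟫ subst (λ v → (at v 0 < at v 1 ⇔ k' 0 < k' 1)) (sym a≡b) (st-sameOrder k' n 0 1 0<n 1<n))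
    where
    0<n = <-≤-trans (s≤s z≤n) 2≤n
    1<n = 2≤n

HasPattern : ℕ → (ℕ → ℕ) → (ℕ → ℕ → Set) → Set
HasPattern n f R = ∀ i j → i < n → j < n → (f i < f j ⇔ R i j)

MonotoneAt : (ℕ → ℕ → Set) → ℕ → Set
MonotoneAt R m = (R 0 1 × R 1 m × R 0 m) ⊎ (R 1 0 × R m 1 × R m 0)

corner-pattern : ∀ {f : ℕ → ℕ} {R : ℕ → ℕ → Set} {m} → (∀ {i j} → R i j → ¬ R j i) → MonotoneAt R m →
  (f 0 < f 1 ⇔ R 0 1) → (f 1 < f 0 ⇔ R 1 0) → (f 1 < f m ⇔ R 1 m) → (f m < f 1 ⇔ R m 1) →
  (f 0 < f m ⇔ R 0 m) × (f m < f 0 ⇔ R m 0)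
corner-pattern asym (inj₁ (r01 , r1m , r0m)) f01 _ f1m _ =
  mk⇔ (λ _ → r0m) (λ _ → f0<fm) , mk⇔ (λ fm<f0 → ⊥-elim (<-asym fm<f0 f0<fm)) (λ rm0 → ⊥-elim (asym rm0 r0m))
  where f0<fm = <-trans (from f01 r01) (from f1m r1m)
corner-pattern asym (inj₂ (r10 , rm1 , rm0)) _ f10 _ fm1 =
  mk⇔ (λ f0<fm → ⊥-elim (<-asym f0<fm fm<f0)) (λ r0m → ⊥-elim (asym r0m rm0)) , mk⇔ (λ _ → rm0) (λ _ → fm<f0)
  where fm<f0 = <-trans (from fm1 rm1) (from f10 r10)

-- If a has a shift-invariant pattern R that is monotone at 0, 1 and the
-- last position m, then every 2-cycle a → b → a is degenerate: the edge
-- a → b gives b the pattern R on positions 0, …, m-1, the edge b → a on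
-- positions 1, …, m, and corner-pattern settles the pair 0, m.
monotone-twoCycle-trivial : ∀ m {a b} → 2 ≤ m → IsPerm (suc m) a → IsPerm (suc m) b →
  Edge (suc m) a b → Edge (suc m) b a → (R : ℕ → ℕ → Set) → (∀ i j → R (suc i) (suc j) ⇔ R i j) →
  (∀ {i j} → R i j → ¬ R j i) → MonotoneAt R m → HasPattern (suc m) (at a) R → a ≡ b
monotone-twoCycle-trivial (suc m') {a} {b} 2≤m a-perm b-perm a→b b→a R R-shift R-asym R-mono a~R =
  perm-unique a b a-perm b-perm (λ i j i<n j<n → a~R i j i<n j<n ⟫ ⇔-sym (b~R i j i<n j<n))
  where
  m = suc m'
  n = suc m
  head-pattern : ∀ i j → suc i < n → suc j < n → (at b i < at b j ⇔ R i j)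
  head-pattern i j 1+i<n 1+j<n = ⇔-sym (edge-shift a→b i j 1+i<n 1+j<n) ⟫ a~R (suc i) (suc j) 1+i<n 1+j<n ⟫ R-shift i j
  tail-pattern : ∀ i j → suc i < n → suc j < n → (at b (suc i) < at b (suc j) ⇔ R (suc i) (suc j))
  tail-pattern i j 1+i<n 1+j<n =
    edge-shift b→a i j 1+i<n 1+j<n ⟫ a~R i j (<-trans (n<1+n i) 1+i<n) (<-trans (n<1+n j) 1+j<n) ⟫ ⇔-sym (R-shift i j)
  1<n : 1 < n
  1<n = s≤s (<-≤-trans (s≤s z≤n) 2≤m)
  2<n : 2 < n
  2<n = s≤s 2≤m
  corners : (at b 0 < at b m ⇔ R 0 m) × (at b m < at b 0 ⇔ R m 0)
  corners = corner-pattern {at b} (λ {i} {j} → R-asym {i} {j}) R-mono (head-pattern 0 1 1<n 2<n) (head-pattern 1 0 2<n 1<n)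
    (tail-pattern 0 m' 1<n ≤-refl) (tail-pattern m' 0 ≤-refl 1<n)
  b~R : HasPattern n (at b) R
  b~R zero zero _ _ = head-pattern 0 0 1<n 1<n
  b~R (suc i) (suc j) 1+i<n 1+j<n = tail-pattern i j 1+i<n 1+j<n
  b~R zero (suc j) _ 1+j<n with suc (suc j) <? n
  ... | yes 2+j<n = head-pattern 0 (suc j) 1<n 2+j<n
  ... | no 2+j≮n with ≤-antisym (s≤s⁻¹ 1+j<n) (s≤s⁻¹ (≮⇒≥ 2+j≮n))
  ... | refl = proj₁ corners
  b~R (suc i) zero 1+i<n _ with suc (suc i) <? n
  ... | yes 2+i<n = head-pattern (suc i) 0 2+i<n 1<n
  ... | no 2+i≮n with ≤-antisym (s≤s⁻¹ 1+i<n) (s≤s⁻¹ (≮⇒≥ 2+i≮n))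
  ... | refl = proj₂ corners

maxUpTo : ℕ → (ℕ → ℕ) → ℕ
maxUpTo zero k = 0
maxUpTo (suc m) k = k m ⊔ maxUpTo m k

maxUpTo-bound : ∀ m k i → i < m → k i ≤ maxUpTo m k
maxUpTo-bound (suc m) k i i<1+m with m≤n⇒m<n∨m≡n (s≤s⁻¹ i<1+m)
... | inj₁ i<m = m≤n⇒m≤o⊔n (k m) (maxUpTo-bound m k i i<m)
... | inj₂ refl = m≤m⊔n (k i) (maxUpTo m k)

reverse : ℕ → (ℕ → ℕ) → ℕ → ℕ
reverse m k i = maxUpTo m k ∸ k i

∸-flip : ∀ {C x y} → x ≤ C → y ≤ C → (C ∸ x < C ∸ y ⇔ y < x)
∸-flip {C} {x} {y} x≤C y≤C = mk⇔ flip⇒ (λ y<x → ∸-monoʳ-< y<x x≤C)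
  where
  flip⇒ : C ∸ x < C ∸ y → y < x
  flip⇒ C∸x<C∸y with <-cmp y x
  ... | tri< y<x _ _ = y<x
  ... | tri≈ _ refl _ = ⊥-elim (<-irrefl refl C∸x<C∸y)
  ... | tri> _ _ x<y = ⊥-elim (<-asym C∸x<C∸y (∸-monoʳ-< x<y y≤C))

reverse-order : ∀ m k {i j} → i < m → j < m → (reverse m k i < reverse m k j ⇔ k j < k i)
reverse-order m k i<m j<m = ∸-flip (maxUpTo-bound m k _ i<m) (maxUpTo-bound m k _ j<m)

reverse-injective : ∀ m k → InjectiveOn m k → InjectiveOn m (reverse m k)
reverse-injective m k inj i j i<m j<m rᵢ≡rⱼ =
  inj i j i<m j<m (∸-cancelˡ-≡ (maxUpTo-bound m k i i<m) (maxUpTo-bound m k j j<m) rᵢ≡rⱼ)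

reverse-periodic : ∀ m k → TwoPeriodic m k → TwoPeriodic m (reverse m k)
reverse-periodic m k k-per i j 2+i<m 2+j<m =
  reverse-order m k (<-trans (m<n⇒m<1+n (n<1+n i)) 2+i<m) (<-trans (m<n⇒m<1+n (n<1+n j)) 2+j<m)
  ⟫ k-per j i 2+j<m 2+i<m ⟫ ⇔-sym (reverse-order m k 2+i<m 2+j<m)

reverse-zigzag : ∀ m k → 3 ≤ m → Zigzag k → Zigzag (reverse m k)
reverse-zigzag m k 3≤m (inj₁ (k₀<k₁ , k₂<k₁)) =
  inj₂ (from (reverse-order m k 1<m 0<m) k₀<k₁ , from (reverse-order m k 1<m 3≤m) k₂<k₁)
  where 0<m = <-≤-trans (s≤s z≤n) 3≤m ; 1<m = <-≤-trans (s≤s (s≤s z≤n)) 3≤m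
reverse-zigzag m k 3≤m (inj₂ (k₁<k₀ , k₁<k₂)) =
  inj₁ (from (reverse-order m k 0<m 1<m) k₁<k₀ , from (reverse-order m k 3≤m 1<m) k₁<k₂)
  where 0<m = <-≤-trans (s≤s z≤n) 3≤m ; 1<m = <-≤-trans (s≤s (s≤s z≤n)) 3≤m

reverse-sameOrder : ∀ {n m f k} → n ≤ m → SameOrder n (reverse n f) k → SameOrder n f (reverse m k)
reverse-sameOrder {n} {m} {f} {k} n≤m rf~k i j i<n j<n =
  ⇔-sym (reverse-order n f j<n i<n) ⟫ rf~k j i j<n i<n ⟫ ⇔-sym (reverse-order m k (≤-trans i<n n≤m) (≤-trans j<n n≤m))

reverse-cancel : ∀ {n m k k'} → n ≤ m → SameOrder n (reverse m k) (reverse m k') → SameOrder n k k'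
reverse-cancel {n} {m} {k} {k'} n≤m rk~rk' i j i<n j<n =
  ⇔-sym (reverse-order m k j<m i<m) ⟫ rk~rk' j i j<n i<n ⟫ reverse-order m k' j<m i<m
  where i<m = ≤-trans i<n n≤m ; j<m = ≤-trans j<n n≤m

double : ℕ → ℕ
double zero = 0
double (suc k) = suc (suc (double k))

evenOrOdd : ∀ j → (Σ ℕ λ a → j ≡ double a) ⊎ (Σ ℕ λ a → j ≡ suc (double a))
evenOrOdd zero = inj₁ (0 , refl)
evenOrOdd (suc zero) = inj₂ (0 , refl)
evenOrOdd (suc (suc j)) with evenOrOdd j
... | inj₁ (a , refl) = inj₁ (suc a , refl)
... | inj₂ (a , refl) = inj₂ (suc a , refl)

byParity : ∀ n (P : ℕ → Set) → (∀ a → double a < n → P (double a)) →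
  (∀ a → suc (double a) < n → P (suc (double a))) → ∀ j → j < n → P j
byParity n P even odd j j<n with evenOrOdd j
... | inj₁ (a , refl) = even a j<n
... | inj₂ (a , refl) = odd a j<n

double-mono-< : ∀ {x y} → x < y → double x < double y
double-mono-< {zero} {suc y} _ = s≤s z≤n
double-mono-< {suc x} {suc y} (s≤s x<y) = s≤s (s≤s (double-mono-< x<y))

double-mono-≤ : ∀ {x y} → x ≤ y → double x ≤ double y
double-mono-≤ {zero} _ = z≤n
double-mono-≤ {suc x} {suc y} (s≤s x≤y) = s≤s (s≤s (double-mono-≤ x≤y))

double-≥ : ∀ a → a ≤ double a
double-≥ zero = z≤n
double-≥ (suc a) = s≤s (m≤n⇒m≤1+n (double-≥ a))

even-half< : ∀ {a m} → double a < m → a < m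
even-half< {a} = ≤-<-trans (double-≥ a)

odd-half< : ∀ {a m} → suc (double a) < m → a < m
odd-half< {a} 1+2a<m = ≤-<-trans (double-≥ a) (<-trans (n<1+n _) 1+2a<m)

double-injective : ∀ {x y} → double x ≡ double y → x ≡ y
double-injective {zero} {zero} _ = refl
double-injective {suc x} {suc y} 2x≡2y = cong suc (double-injective (suc-injective (suc-injective 2x≡2y)))

double≢odd : ∀ x y → double x ≢ suc (double y)
double≢odd (suc x) (suc y) 2x≡2y+1 = double≢odd x y (suc-injective (suc-injective 2x≡2y+1))
double≢odd (suc zero) zero ()
double≢odd (suc (suc x)) zero ()

double<double : ∀ x y → (double x < double y ⇔ x < y)
double<double x y = mk⇔ halve double-mono-<
  where
  halve : double x < double y → x < y
  halve 2x<2y with <-cmp x y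
  ... | tri< x<y _ _ = x<y
  ... | tri≈ _ refl _ = ⊥-elim (<-irrefl refl 2x<2y)
  ... | tri> _ _ y<x = ⊥-elim (<-asym 2x<2y (double-mono-< y<x))

double<odd : ∀ x y → (double x < suc (double y) ⇔ x ≤ y)
double<odd x y =
  mk⇔ (λ 2x≤2y → ≮⇒≥ λ y<x → <⇒≱ (double-mono-< y<x) (s≤s⁻¹ 2x≤2y)) (λ x≤y → s≤s (double-mono-≤ x≤y))

odd<double : ∀ x y → (suc (double x) < double y ⇔ x < y)
odd<double x y = mk⇔ halve (grow x y)
  where
  halve : suc (double x) < double y → x < y
  halve 2x+1<2y = to (double<double x y) (<-trans (n<1+n _) 2x+1<2y)
  grow : ∀ x y → x < y → suc (double x) < double y
  grow zero (suc y) _ = s≤s (s≤s z≤n)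
  grow (suc x) (suc y) (s≤s x<y) = s≤s (s≤s (grow x y x<y))

odd<odd : ∀ x y → (suc (double x) < suc (double y) ⇔ x < y)
odd<odd x y = mk⇔ (λ 2x+1<2y+1 → to (double<double x y) (s≤s⁻¹ 2x+1<2y+1)) (λ x<y → s≤s (double-mono-< x<y))

even<⇔ : ∀ n a → (double a < n ⇔ a < ⌈ n /2⌉)
even<⇔ zero a = mk⇔ (λ ()) (λ ())
even<⇔ (suc zero) zero = mk⇔ (λ _ → ≤-refl) (λ _ → ≤-refl)
even<⇔ (suc zero) (suc a) = mk⇔ (λ { (s≤s ()) }) (λ { (s≤s ()) })
even<⇔ (suc (suc n)) zero = mk⇔ (λ _ → s≤s z≤n) (λ _ → s≤s z≤n)
even<⇔ (suc (suc n)) (suc a) =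
  mk⇔ (λ 2a<n → s≤s (to (even<⇔ n a) (s≤s⁻¹ (s≤s⁻¹ 2a<n)))) (λ a<n → s≤s (s≤s (from (even<⇔ n a) (s≤s⁻¹ a<n))))

odd<⇔ : ∀ n a → (suc (double a) < n ⇔ a < ⌊ n /2⌋)
odd<⇔ zero a = mk⇔ (λ ()) (λ ())
odd<⇔ (suc zero) a = mk⇔ (λ { (s≤s ()) }) (λ ())
odd<⇔ (suc (suc n)) zero = mk⇔ (λ _ → s≤s z≤n) (λ _ → s≤s (s≤s z≤n))
odd<⇔ (suc (suc n)) (suc a) =
  mk⇔ (λ 2a+1<n → s≤s (to (odd<⇔ n a) (s≤s⁻¹ (s≤s⁻¹ 2a+1<n)))) (λ a<n → s≤s (s≤s (from (odd<⇔ n a) (s≤s⁻¹ a<n))))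

periodic-shift : ∀ {n f} → TwoPeriodic n f → ∀ t i j → double t + i < n → double t + j < n →
  (f i < f j ⇔ f (double t + i) < f (double t + j))
periodic-shift f-per zero i j _ _ = ⇔-refl
periodic-shift f-per (suc t) i j 2t+2+i<n 2t+2+j<n =
  periodic-shift f-per t i j (<-trans (m<n⇒m<1+n (n<1+n _)) 2t+2+i<n) (<-trans (m<n⇒m<1+n (n<1+n _)) 2t+2+j<n)
  ⟫ f-per (double t + i) (double t + j) 2t+2+i<n 2t+2+j<n

chain : ∀ (R : ℕ → ℕ → Set) → (∀ {x y z} → R x y → R y z → R x z) → ∀ (g : ℕ → ℕ) m →
  (∀ k → suc k < m → R (g k) (g (suc k))) → ∀ k k' → k < k' → k' < m → R (g k) (g k')
chain R R-trans g m step k (suc k') (s≤s k≤k') 1+k'<m with k ≟ k'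
... | yes refl = step k 1+k'<m
... | no k≢k' = R-trans (chain R R-trans g m step k k' (≤∧≢⇒< k≤k' k≢k') (<-trans (n<1+n k') 1+k'<m)) (step k' 1+k'<m)

threshold : ∀ (P : ℕ → Set) → (∀ k → Dec (P k)) → ∀ m → (∀ k k' → k ≤ k' → k' < m → P k' → P k) →
  Σ ℕ λ T → T ≤ m × (∀ k → k < m → (P k ⇔ k < T))
threshold P P? zero _ = 0 , z≤n , λ k ()
threshold P P? (suc m) downward with threshold P P? m (λ k k' k≤k' k'<m → downward k k' k≤k' (m<n⇒m<1+n k'<m))
... | T , T≤m , P⇔<T with T ≟ m
... | no T≢m = T , m≤n⇒m≤1+n T≤m , extend
  where
  T<m = ≤∧≢⇒< T≤m T≢m
  extend : ∀ k → k < suc m → (P k ⇔ k < T)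
  extend k k<1+m with k ≟ m
  ... | no k≢m = P⇔<T k (≤∧≢⇒< (s≤s⁻¹ k<1+m) k≢m)
  ... | yes refl = mk⇔ (λ Pm → ⊥-elim (<-irrefl refl (to (P⇔<T T T<m) (downward T k T≤m (n<1+n k) Pm))))
                       (λ k<T → ⊥-elim (<-asym k<T T<m))
... | yes refl with P? T
... | yes PT = suc T , ≤-refl , λ k k<1+T → mk⇔ (λ _ → k<1+T) (λ _ → all k k<1+T)
  where
  all : ∀ k → k < suc T → P k
  all k k<1+T with k ≟ T
  ... | yes refl = PT
  ... | no k≢T = from (P⇔<T k (≤∧≢⇒< (s≤s⁻¹ k<1+T) k≢T)) (≤∧≢⇒< (s≤s⁻¹ k<1+T) k≢T)
... | no ¬PT = T , n≤1+n T , extend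
  where
  extend : ∀ k → k < suc T → (P k ⇔ k < T)
  extend k k<1+T with k ≟ T
  ... | yes refl = mk⇔ (λ PT → ⊥-elim (¬PT PT)) (λ T<T → ⊥-elim (<-irrefl refl T<T))
  ... | no k≢T = P⇔<T k (≤∧≢⇒< (s≤s⁻¹ k<1+T) k≢T)

flip-comparison : ∀ {n f g} → InjectiveOn n f → InjectiveOn n g → ∀ i j → i < n → j < n →
  (f j < f i ⇔ g j < g i) → (f i < f j ⇔ g i < g j)
flip-comparison {n} {f} {g} f-inj g-inj i j i<n j<n fⱼᵢ⇔gⱼᵢ =
  mk⇔ (transfer f g g-inj (⇔-sym fⱼᵢ⇔gⱼᵢ)) (transfer g f f-inj fⱼᵢ⇔gⱼᵢ)
  where
  transfer : ∀ f g → InjectiveOn n g → (g j < g i ⇔ f j < f i) → f i < f j → g i < g j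
  transfer f g g-inj gⱼᵢ⇔fⱼᵢ fᵢ<fⱼ with <-cmp (g i) (g j)
  ... | tri< gᵢ<gⱼ _ _ = gᵢ<gⱼ
  ... | tri≈ _ gᵢ≡gⱼ _ with g-inj i j i<n j<n gᵢ≡gⱼ
  ... | refl = ⊥-elim (<-irrefl refl fᵢ<fⱼ)
  transfer f g g-inj gⱼᵢ⇔fⱼᵢ fᵢ<fⱼ | tri> _ _ gⱼ<gᵢ = ⊥-elim (<-asym fᵢ<fⱼ (to gⱼᵢ⇔fⱼᵢ gⱼ<gᵢ))

sameOrder-from-first-two : ∀ {n f g} → InjectiveOn n f → InjectiveOn n g → TwoPeriodic n f → TwoPeriodic n g →
  (∀ j → j < n → (f j < f 0 ⇔ g j < g 0)) → (∀ j → j < n → (f j < f 1 ⇔ g j < g 1)) → SameOrder n f g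
sameOrder-from-first-two {n} {f} {g} f-inj g-inj f-per g-per vs0 vs1 = same
  where
  same : SameOrder n f g
  same zero j 0<n j<n = flip-comparison f-inj g-inj 0 j 0<n j<n (vs0 j j<n)
  same (suc zero) j 1<n j<n = flip-comparison f-inj g-inj 1 j 1<n j<n (vs1 j j<n)
  same (suc (suc i)) zero 2+i<n _ = vs0 _ 2+i<n
  same (suc (suc i)) (suc zero) 2+i<n _ = vs1 _ 2+i<n
  same (suc (suc i)) (suc (suc j)) 2+i<n 2+j<n =
    ⇔-sym (f-per i j 2+i<n 2+j<n)
    ⟫ same i j (<-trans (m<n⇒m<1+n (n<1+n i)) 2+i<n) (<-trans (m<n⇒m<1+n (n<1+n j)) 2+j<n)
    ⟫ g-per i j 2+i<n 2+j<n

initial-segment : ∀ (g : ℕ → ℕ) m x → (∀ a b → a < b → b < m → g a < g b) →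
  Σ ℕ λ T → T ≤ m × (∀ a → a < m → (g a < x ⇔ a < T))
initial-segment g m x g↑ = threshold (λ a → g a < x) (λ a → g a <? x) m downward
  where
  downward : ∀ a b → a ≤ b → b < m → g b < x → g a < x
  downward a b a≤b b<m gb<x with m≤n⇒m<n∨m≡n a≤b
  ... | inj₁ a<b = <-trans (g↑ a b a<b b<m) gb<x
  ... | inj₂ refl = gb<x

+-cancelʳ-<⇔ : ∀ a b c → (a + c < b + c ⇔ a < b)
+-cancelʳ-<⇔ a b c = mk⇔ (+-cancelʳ-< c a b) (+-monoˡ-< c)

evenOdd : (ℕ → ℕ) → (ℕ → ℕ) → ℕ → ℕ
evenOdd e o zero = e 0
evenOdd e o (suc zero) = o 0
evenOdd e o (suc (suc i)) = evenOdd (λ a → e (suc a)) (λ a → o (suc a)) i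

evenOdd-even : ∀ e o a → evenOdd e o (double a) ≡ e a
evenOdd-even e o zero = refl
evenOdd-even e o (suc a) = evenOdd-even (λ a → e (suc a)) (λ a → o (suc a)) a

evenOdd-odd : ∀ e o a → evenOdd e o (suc (double a)) ≡ o a
evenOdd-odd e o zero = refl
evenOdd-odd e o (suc a) = evenOdd-odd (λ a → e (suc a)) (λ a → o (suc a)) a

ShiftCompatible : ℕ → (ℕ → ℕ) → (ℕ → ℕ) → Set
ShiftCompatible m f g = ∀ a b → a < m → b < m → (f a < g b ⇔ f (suc a) < g (suc b))

-- Shifting a position by 2 shifts the index within its parity class by
-- 1, so evenOdd e o is 2-periodic when the four shift conditions hold.
evenOdd-periodic : ∀ {m} e o → ShiftCompatible m e e → ShiftCompatible m o o → ShiftCompatible m e o →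
  ShiftCompatible m o e → TwoPeriodic (2 + m) (evenOdd e o)
evenOdd-periodic {m} e o ee oo eo oe i j 2+i<2+m 2+j<2+m = shift i j (s≤s⁻¹ (s≤s⁻¹ 2+i<2+m)) (s≤s⁻¹ (s≤s⁻¹ 2+j<2+m))
  where
  k = evenOdd e o
  shift : ∀ i j → i < m → j < m → (k i < k j ⇔ k (2 + i) < k (2 + j))
  shift i j i<m j<m with evenOrOdd i | evenOrOdd j
  ... | inj₁ (a , refl) | inj₁ (b , refl)
    rewrite evenOdd-even e o a | evenOdd-even e o b | evenOdd-even e o (suc a) | evenOdd-even e o (suc b) =
    ee a b (even-half< i<m) (even-half< j<m)
  ... | inj₂ (a , refl) | inj₂ (b , refl)
    rewrite evenOdd-odd e o a | evenOdd-odd e o b | evenOdd-odd e o (suc a) | evenOdd-odd e o (suc b) =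
    oo a b (odd-half< i<m) (odd-half< j<m)
  ... | inj₁ (a , refl) | inj₂ (b , refl)
    rewrite evenOdd-even e o a | evenOdd-odd e o b | evenOdd-even e o (suc a) | evenOdd-odd e o (suc b) =
    eo a b (even-half< i<m) (odd-half< j<m)
  ... | inj₂ (a , refl) | inj₁ (b , refl)
    rewrite evenOdd-odd e o a | evenOdd-even e o b | evenOdd-odd e o (suc a) | evenOdd-even e o (suc b) =
    oe a b (odd-half< i<m) (even-half< j<m)

evenOdd-injective : ∀ {m} e o → InjectiveOn m e → InjectiveOn m o → (∀ a b → a < m → b < m → e a ≢ o b) →
  InjectiveOn m (evenOdd e o)
evenOdd-injective {m} e o e-inj o-inj e≢o i j i<m j<m kᵢ≡kⱼ with evenOrOdd i | evenOrOdd j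
... | inj₁ (a , refl) | inj₁ (b , refl) rewrite evenOdd-even e o a | evenOdd-even e o b =
  cong double (e-inj a b (even-half< i<m) (even-half< j<m) kᵢ≡kⱼ)
... | inj₂ (a , refl) | inj₂ (b , refl) rewrite evenOdd-odd e o a | evenOdd-odd e o b =
  cong (λ x → suc (double x)) (o-inj a b (odd-half< i<m) (odd-half< j<m) kᵢ≡kⱼ)
... | inj₁ (a , refl) | inj₂ (b , refl) rewrite evenOdd-even e o a | evenOdd-odd e o b =
  ⊥-elim (e≢o a b (even-half< i<m) (odd-half< j<m) kᵢ≡kⱼ)
... | inj₂ (a , refl) | inj₁ (b , refl) rewrite evenOdd-odd e o a | evenOdd-even e o b =
  ⊥-elim (e≢o b a (even-half< j<m) (odd-half< i<m) (sym kᵢ≡kⱼ))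

-- Evens and odds both increasing: even position 2a gets 4(a + h) and odd
-- position 2a+1 gets 4(a + u) + 2, so 2a precedes 2b+1 iff a + h ≤ b + u.
-- With h = ⌊ n /2⌋ the parameter u < n runs through all n interleavings;
-- u = h is the identity pattern.
interleaving : ℕ → ℕ → ℕ → ℕ
interleaving h u = evenOdd (λ a → double (double (a + h))) (λ a → double (suc (double (a + u))))

+4-compatible : ∀ m (f g : ℕ → ℕ) → (∀ a → f (suc a) ≡ 4 + f a) → (∀ a → g (suc a) ≡ 4 + g a) →
  ShiftCompatible m f g
+4-compatible m f g f+4 g+4 a b _ _ rewrite f+4 a | g+4 b =
  mk⇔ (λ fa<gb → s≤s (s≤s (s≤s (s≤s fa<gb)))) (λ fa+4<gb+4 → s≤s⁻¹ (s≤s⁻¹ (s≤s⁻¹ (s≤s⁻¹ fa+4<gb+4))))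

interleaving-even : ∀ h u a → interleaving h u (double a) ≡ double (double (a + h))
interleaving-even h u = evenOdd-even _ _

interleaving-odd : ∀ h u a → interleaving h u (suc (double a)) ≡ double (suc (double (a + u)))
interleaving-odd h u = evenOdd-odd _ _

-- Both values advance by 4 when the index advances by 1.
interleaving-periodic : ∀ h u n → TwoPeriodic n (interleaving h u)
interleaving-periodic h u n = twoPeriodic-≤ (m≤n+m n 2) (evenOdd-periodic e o
  (+4-compatible n e e (λ _ → refl) (λ _ → refl)) (+4-compatible n o o (λ _ → refl) (λ _ → refl))
  (+4-compatible n e o (λ _ → refl) (λ _ → refl)) (+4-compatible n o e (λ _ → refl) (λ _ → refl)))
  where
  e = λ a → double (double (a + h))
  o = λ a → double (suc (double (a + u)))

interleaving-ee : ∀ h u a b → (interleaving h u (double a) < interleaving h u (double b) ⇔ a < b)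
interleaving-ee h u a b rewrite interleaving-even h u a | interleaving-even h u b =
  double<double (double (a + h)) (double (b + h)) ⟫ double<double (a + h) (b + h) ⟫ +-cancelʳ-<⇔ a b h

interleaving-oo : ∀ h u a b → (interleaving h u (suc (double a)) < interleaving h u (suc (double b)) ⇔ a < b)
interleaving-oo h u a b rewrite interleaving-odd h u a | interleaving-odd h u b =
  double<double (suc (double (a + u))) (suc (double (b + u))) ⟫ odd<odd (a + u) (b + u) ⟫ +-cancelʳ-<⇔ a b u

interleaving-eo : ∀ h u a b → (interleaving h u (double a) < interleaving h u (suc (double b)) ⇔ a + h ≤ b + u)
interleaving-eo h u a b rewrite interleaving-even h u a | interleaving-odd h u b =
  double<double (double (a + h)) (suc (double (b + u))) ⟫ double<odd (a + h) (b + u)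

interleaving-oe : ∀ h u a b → (interleaving h u (suc (double a)) < interleaving h u (double b) ⇔ a + u < b + h)
interleaving-oe h u a b rewrite interleaving-odd h u a | interleaving-even h u b =
  double<double (suc (double (a + u))) (double (b + h)) ⟫ odd<double (a + u) (b + h)

interleaving-injective : ∀ h u m → InjectiveOn m (interleaving h u)
interleaving-injective h u m = evenOdd-injective _ _
  (λ a b _ _ 4[a+h]≡4[b+h] → +-cancelʳ-≡ h a b (double-injective (double-injective 4[a+h]≡4[b+h])))
  (λ a b _ _ 4[a+u]+2≡4[b+u]+2 → +-cancelʳ-≡ u a b (double-injective (suc-injective (double-injective 4[a+u]+2≡4[b+u]+2))))
  (λ a b _ _ 4[a+h]≡4[b+u]+2 → double≢odd (a + h) (b + u) (double-injective 4[a+h]≡4[b+u]+2))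

-- With the spread 2m + 1, the values
-- a at even positions lie below the values spread m ∸ b at odd positions
-- (oddsAbove m), while the values a + spread m lie above the values
-- spread m ∸ (b + 1) (oddsBelow m).
spread : ℕ → ℕ
spread m = suc (m + m)

oddsAbove : ℕ → ℕ → ℕ
oddsAbove m = evenOdd (λ a → a) (λ a → spread m ∸ a)

oddsBelow : ℕ → ℕ → ℕ
oddsBelow m = evenOdd (λ a → a + spread m) (λ a → spread m ∸ suc a)

suc≤spread : ∀ {m a} → a ≤ m → suc a ≤ spread m
suc≤spread {m} a≤m = s≤s (≤-trans a≤m (m≤m+n m m))

≤spread : ∀ {m a} → a ≤ m → a ≤ spread m
≤spread a≤m = m≤n⇒m≤1+n (s≤s⁻¹ (suc≤spread a≤m))

evens-below-odds : ∀ {m a b} → a ≤ m → b ≤ m → a < spread m ∸ b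
evens-below-odds {m} {a} a≤m b≤m = m+n≤o⇒m≤o∸n (suc a) (s≤s (+-mono-≤ a≤m b≤m))

odds-below-evens : ∀ m a b → spread m ∸ suc a < b + spread m
odds-below-evens m a b = <-≤-trans (s≤s (m∸n≤m (m + m) a)) (m≤n+m (spread m) b)

suc-cancel-< : ∀ a b → (suc a < suc b ⇔ a < b)
suc-cancel-< a b = mk⇔ s≤s⁻¹ s≤s

oddsAbove-periodic : ∀ m → TwoPeriodic (2 + m) (oddsAbove m)
oddsAbove-periodic m = evenOdd-periodic _ _
  (λ a b _ _ → ⇔-sym (suc-cancel-< a b))
  (λ a b a<m b<m → ∸-flip (≤spread (<⇒≤ a<m)) (≤spread (<⇒≤ b<m)) ⟫ ⇔-sym (suc-cancel-< b a)
                   ⟫ ⇔-sym (∸-flip (suc≤spread (<⇒≤ a<m)) (suc≤spread (<⇒≤ b<m))))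
  (λ a b a<m b<m → both-true (evens-below-odds (<⇒≤ a<m) (<⇒≤ b<m)) (evens-below-odds a<m b<m))
  (λ a b a<m b<m → both-false (<-asym (evens-below-odds (<⇒≤ b<m) (<⇒≤ a<m))) (<-asym (evens-below-odds b<m a<m)))

oddsAbove-injective : ∀ m → InjectiveOn m (oddsAbove m)
oddsAbove-injective m = evenOdd-injective _ _
  (λ _ _ _ _ a≡b → a≡b)
  (λ a b a<m b<m → ∸-cancelˡ-≡ (≤spread (<⇒≤ a<m)) (≤spread (<⇒≤ b<m)))
  (λ a b a<m b<m → <⇒≢ (evens-below-odds (<⇒≤ a<m) (<⇒≤ b<m)))

oddsBelow-periodic : ∀ m → TwoPeriodic (2 + m) (oddsBelow m)
oddsBelow-periodic m = evenOdd-periodic _ _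
  (λ a b _ _ → ⇔-sym (suc-cancel-< (a + spread m) (b + spread m)))
  (λ a b a<m b<m → ∸-flip (suc≤spread (<⇒≤ a<m)) (suc≤spread (<⇒≤ b<m)) ⟫ ⇔-sym (suc-cancel-< (suc b) (suc a))
                   ⟫ ⇔-sym (∸-flip (suc≤spread a<m) (suc≤spread b<m)))
  (λ a b _ _ → both-false (<-asym (odds-below-evens m b a)) (<-asym (odds-below-evens m (suc b) (suc a))))
  (λ a b _ _ → both-true (odds-below-evens m a b) (odds-below-evens m (suc a) (suc b)))

oddsBelow-injective : ∀ m → InjectiveOn m (oddsBelow m)
oddsBelow-injective m = evenOdd-injective _ _
  (λ a b _ _ → +-cancelʳ-≡ (spread m) a b)
  (λ a b a<m b<m → suc-injective ∘′ ∸-cancelˡ-≡ (suc≤spread (<⇒≤ a<m)) (suc≤spread (<⇒≤ b<m)))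
  (λ a b _ _ a+D≡D∸b → <-irrefl (sym a+D≡D∸b) (odds-below-evens m b a))

oddsAbove-even : ∀ m a → oddsAbove m (double a) ≡ a
oddsAbove-even m = evenOdd-even _ _

oddsAbove-odd : ∀ m a → oddsAbove m (suc (double a)) ≡ spread m ∸ a
oddsAbove-odd m = evenOdd-odd _ _

oddsBelow-even : ∀ m a → oddsBelow m (double a) ≡ a + spread m
oddsBelow-even m = evenOdd-even _ _

oddsBelow-odd : ∀ m a → oddsBelow m (suc (double a)) ≡ spread m ∸ suc a
oddsBelow-odd m = evenOdd-odd _ _

-- The 2n + 4 shapes of 2-periodic patterns of length n.  A core shape has
-- increasing evens: with increasing odds interleaved by u < n, or with
-- decreasing odds above or below the evens.
data CoreShape : Set where
  inter : ℕ → CoreShape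
  oddsHigh oddsLow : CoreShape

data Shape : Set where
  plain reversed : CoreShape → Shape

ValidCore : ℕ → CoreShape → Set
ValidCore n (inter u) = u < n
ValidCore n oddsHigh = ⊤
ValidCore n oddsLow = ⊤

Valid : ℕ → Shape → Set
Valid n (plain c) = ValidCore n c
Valid n (reversed c) = ValidCore n c

-- Keys realising the shapes on n + 2 positions (one more than an edge
-- needs, so that the partner vertex of a 2-cycle is realised too).
coreKey : ℕ → CoreShape → ℕ → ℕ
coreKey n (inter u) = interleaving ⌊ n /2⌋ u
coreKey n oddsHigh = oddsAbove (2 + n)
coreKey n oddsLow = oddsBelow (2 + n)

key : ℕ → Shape → ℕ → ℕ
key n (plain c) = coreKey n c
key n (reversed c) = reverse (2 + n) (coreKey n c)

module EvensIncreasing (n : ℕ) (f : ℕ → ℕ) (4≤n : 4 ≤ n) (f-inj : InjectiveOn n f) (f-per : TwoPeriodic n f)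
                       (f₀<f₂ : f 0 < f 2) where

  h e : ℕ
  h = ⌊ n /2⌋
  e = ⌈ n /2⌉

  0<n = 4≤⇒0< 4≤n
  1<n = 4≤⇒1< 4≤n
  2<n = 4≤⇒2< 4≤n
  3<n = 4≤n

  recur : ∀ t {i j i' j'} → double t + i ≡ i' → double t + j ≡ j' → f i < f j → i' < n → j' < n → f i' < f j'
  recur t refl refl fᵢ<fⱼ i'<n j'<n = to (periodic-shift f-per t _ _ i'<n j'<n) fᵢ<fⱼ

  evens↑ : ∀ a b → a < b → double b < n → f (double a) < f (double b)
  evens↑ a b a<b 2b<n = chain _<_ <-trans (λ k → f (double k)) e step a b a<b (to (even<⇔ n b) 2b<n)
    where
    step : ∀ k → suc k < e → f (double k) < f (double (suc k))
    step k 1+k<e = recur k (+-identityʳ _) (+-comm _ 2) f₀<f₂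
      (from (even<⇔ n k) (<-trans (n<1+n k) 1+k<e)) (from (even<⇔ n (suc k)) 1+k<e)

  odds↑ : f 1 < f 3 → ∀ a b → a < b → suc (double b) < n → f (suc (double a)) < f (suc (double b))
  odds↑ f₁<f₃ a b a<b 2b+1<n = chain _<_ <-trans (λ k → f (suc (double k))) h step a b a<b (to (odd<⇔ n b) 2b+1<n)
    where
    step : ∀ k → suc k < h → f (suc (double k)) < f (suc (double (suc k)))
    step k 1+k<h = recur k (+-comm _ 1) (+-comm _ 3) f₁<f₃
      (from (odd<⇔ n k) (<-trans (n<1+n k) 1+k<h)) (from (odd<⇔ n (suc k)) 1+k<h)

  odds↓ : f 3 < f 1 → ∀ a b → a < b → suc (double b) < n → f (suc (double b)) < f (suc (double a))
  odds↓ f₃<f₁ a b a<b 2b+1<n =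
    chain (λ x y → y < x) (λ y<x z<y → <-trans z<y y<x) (λ k → f (suc (double k))) h step a b a<b (to (odd<⇔ n b) 2b+1<n)
    where
    step : ∀ k → suc k < h → f (suc (double (suc k))) < f (suc (double k))
    step k 1+k<h = recur k (+-comm _ 3) (+-comm _ 1) f₃<f₁
      (from (odd<⇔ n (suc k)) 1+k<h) (from (odd<⇔ n k) (<-trans (n<1+n k) 1+k<h))

  f₀≤even : ∀ a → double a < n → f 0 ≤ f (double a)
  f₀≤even zero _ = ≤-refl
  f₀≤even (suc a) 2a+2<n = <⇒≤ (evens↑ 0 (suc a) (s≤s z≤n) 2a+2<n)

  f₁≤odd : f 1 < f 3 → ∀ a → suc (double a) < n → f 1 ≤ f (suc (double a))
  f₁≤odd f₁<f₃ zero _ = ≤-refl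
  f₁≤odd f₁<f₃ (suc a) 2a+3<n = <⇒≤ (odds↑ f₁<f₃ 0 (suc a) (s≤s z≤n) 2a+3<n)

  odd≤f₁ : f 3 < f 1 → ∀ a → suc (double a) < n → f (suc (double a)) ≤ f 1
  odd≤f₁ f₃<f₁ zero _ = ≤-refl
  odd≤f₁ f₃<f₁ (suc a) 2a+3<n = <⇒≤ (odds↓ f₃<f₁ 0 (suc a) (s≤s z≤n) 2a+3<n)

  h<n : h < n
  h<n = <-≤-trans (m<m+n h (to (even<⇔ n 0) 0<n)) (≤-reflexive (⌊n/2⌋+⌈n/2⌉≡n n))

  interleaving-sameOrder : ∀ u → (∀ j → j < n → (f j < f 0 ⇔ interleaving h u j < interleaving h u 0)) →
    (∀ j → j < n → (f j < f 1 ⇔ interleaving h u j < interleaving h u 1)) → SameOrder n f (interleaving h u)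
  interleaving-sameOrder u =
    sameOrder-from-first-two f-inj (interleaving-injective h u n) f-per (interleaving-periodic h u n)

  -- Odds increasing and f 0 < f 1: exactly the first T + 1 evens lie
  -- below f 1, and f has the pattern of interleaving h (h + T).
  interleaving-low : f 1 < f 3 → f 0 < f 1 → Σ ℕ λ u → u < n × SameOrder n f (interleaving h u)
  interleaving-low f₁<f₃ f₀<f₁
    with initial-segment (λ a → f (double a)) e (f 1) (λ a b a<b b<e → evens↑ a b a<b (from (even<⇔ n b) b<e))
  ... | zero , _ , below-f₁⇔ = ⊥-elim (n≮0 (to (below-f₁⇔ 0 (to (even<⇔ n 0) 0<n)) f₀<f₁))
  ... | suc T , T<e , below-f₁⇔ = u , u<n , interleaving-sameOrder u vs0 vs1
    where
    u = h + T
    k = interleaving h u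
    u<n : u < n
    u<n = subst (u <_) (⌊n/2⌋+⌈n/2⌉≡n n) (+-monoʳ-< h T<e)
    a<T+1⇔ : ∀ a → (a < suc T ⇔ a + h ≤ h + T)
    a<T+1⇔ a = mk⇔ (λ a<1+T → subst (a + h ≤_) (+-comm T h) (+-monoˡ-≤ h (s≤s⁻¹ a<1+T)))
                   (λ a+h≤h+T → s≤s (+-cancelʳ-≤ h a T (subst (a + h ≤_) (+-comm h T) a+h≤h+T)))
    vs0 : ∀ j → j < n → (f j < f 0 ⇔ k j < k 0)
    vs0 = byParity n _
      (λ a 2a<n → both-false (≤⇒≯ (f₀≤even a 2a<n)) (λ kₑ<k₀ → n≮0 (to (interleaving-ee h u a 0) kₑ<k₀)))
      (λ a 2a+1<n → both-false (≤⇒≯ (≤-trans (<⇒≤ f₀<f₁) (f₁≤odd f₁<f₃ a 2a+1<n)))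
        (λ kₒ<k₀ → ≤⇒≯ (≤-trans (m≤m+n h T) (m≤n+m u a)) (to (interleaving-oe h u a 0) kₒ<k₀)))
    vs1 : ∀ j → j < n → (f j < f 1 ⇔ k j < k 1)
    vs1 = byParity n _
      (λ a 2a<n → below-f₁⇔ a (to (even<⇔ n a) 2a<n) ⟫ a<T+1⇔ a ⟫ ⇔-sym (interleaving-eo h u a 0))
      (λ a 2a+1<n → both-false (≤⇒≯ (f₁≤odd f₁<f₃ a 2a+1<n))
        (λ kₒ<k₁ → n≮0 (to (interleaving-oo h u a 0) kₒ<k₁)))

  -- Odds increasing and f 1 < f 0: exactly the first T ≥ 1 odds lie below
  -- f 0, and f has the pattern of interleaving h (h - T).
  interleaving-high : f 1 < f 3 → f 1 < f 0 → Σ ℕ λ u → u < n × SameOrder n f (interleaving h u)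
  interleaving-high f₁<f₃ f₁<f₀
    with initial-segment (λ a → f (suc (double a))) h (f 0) (λ a b a<b b<h → odds↑ f₁<f₃ a b a<b (from (odd<⇔ n b) b<h))
  ... | T , T≤h , below-f₀⇔ = u , u<n , interleaving-sameOrder u vs0 vs1
    where
    u = h ∸ T
    k = interleaving h u
    0<T : 0 < T
    0<T = to (below-f₀⇔ 0 (to (odd<⇔ n 0) 1<n)) f₁<f₀
    u<n : u < n
    u<n = ≤-<-trans (m∸n≤m h T) h<n
    a<T⇔ : ∀ a → (a < T ⇔ a + u < h)
    a<T⇔ a = subst (λ x → (a < T ⇔ a + u < x)) (m+[n∸m]≡n T≤h) (⇔-sym (+-cancelʳ-<⇔ a T u))
    vs0 : ∀ j → j < n → (f j < f 0 ⇔ k j < k 0)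
    vs0 = byParity n _
      (λ a 2a<n → both-false (≤⇒≯ (f₀≤even a 2a<n)) (λ kₑ<k₀ → n≮0 (to (interleaving-ee h u a 0) kₑ<k₀)))
      (λ a 2a+1<n → below-f₀⇔ a (to (odd<⇔ n a) 2a+1<n) ⟫ a<T⇔ a ⟫ ⇔-sym (interleaving-oe h u a 0))
    vs1 : ∀ j → j < n → (f j < f 1 ⇔ k j < k 1)
    vs1 = byParity n _
      (λ a 2a<n → both-false (≤⇒≯ (≤-trans (<⇒≤ f₁<f₀) (f₀≤even a 2a<n)))
        (λ kₑ<k₁ → <⇒≱ (<-≤-trans (∸-monoʳ-< 0<T T≤h) (m≤n+m h a)) (to (interleaving-eo h u a 0) kₑ<k₁)))
      (λ a 2a+1<n → both-false (≤⇒≯ (f₁≤odd f₁<f₃ a 2a+1<n))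
        (λ kₒ<k₁ → n≮0 (to (interleaving-oo h u a 0) kₒ<k₁)))

  f₂<f₃ : f 0 < f 1 → f 2 < f 3
  f₂<f₃ f₀<f₁ = recur 1 refl refl f₀<f₁ 2<n 3<n

  even<next-odd : f 0 < f 1 → ∀ a → suc (double a) < n → f (double a) < f (suc (double a))
  even<next-odd f₀<f₁ a 2a+1<n = recur a (+-identityʳ _) (+-comm _ 1) f₀<f₁ (<-trans (n<1+n _) 2a+1<n) 2a+1<n

  m = 2 + n
  n≤m : n ≤ m
  n≤m = m≤n+m n 2

  oddsHigh-sameOrder : f 3 < f 1 → f 0 < f 1 → SameOrder n f (oddsAbove m)
  oddsHigh-sameOrder f₃<f₁ f₀<f₁ = sameOrder-from-first-two f-inj (injectiveOn-≤ k n≤m (oddsAbove-injective m)) f-per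
    (twoPeriodic-≤ (≤-trans n≤m (m≤n+m m 2)) (oddsAbove-periodic m)) (byParity n _ even-vs0 odd-vs0) (byParity n _ even-vs1 odd-vs1)
    where
    k = oddsAbove m
    even-vs0 : ∀ a → double a < n → (f (double a) < f 0 ⇔ k (double a) < k 0)
    even-vs0 a 2a<n = both-false (≤⇒≯ (f₀≤even a 2a<n)) n≮0
    odd-vs0 : ∀ a → suc (double a) < n → (f (suc (double a)) < f 0 ⇔ k (suc (double a)) < k 0)
    odd-vs0 a 2a+1<n =
      both-false (<-asym (≤-<-trans (f₀≤even a (<-trans (n<1+n _) 2a+1<n)) (even<next-odd f₀<f₁ a 2a+1<n))) n≮0
    even-vs1 : ∀ a → double a < n → (f (double a) < f 1 ⇔ k (double a) < k 1)
    even-vs1 zero _ = both-true f₀<f₁ (evens-below-odds {m} z≤n z≤n)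
    even-vs1 (suc a) 2a+2<n rewrite oddsAbove-even m (suc a) =
      both-true (<-≤-trans (recur a (+-comm _ 2) (+-comm _ 1) (<-trans (f₂<f₃ f₀<f₁) f₃<f₁) 2a+2<n 2a+1<n)
                           (odd≤f₁ f₃<f₁ a 2a+1<n))
                (evens-below-odds (<⇒≤ (≤-trans (even-half< 2a+2<n) n≤m)) z≤n)
      where 2a+1<n = <-trans (n<1+n _) 2a+2<n
    odd-vs1 : ∀ a → suc (double a) < n → (f (suc (double a)) < f 1 ⇔ k (suc (double a)) < k 1)
    odd-vs1 zero _ = both-false (<-irrefl refl) (<-irrefl refl)
    odd-vs1 (suc a) 2a+3<n rewrite oddsAbove-odd m (suc a) =
      both-true (odds↓ f₃<f₁ 0 (suc a) (s≤s z≤n) 2a+3<n)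
                (∸-monoʳ-< {spread m} {suc a} {0} (s≤s z≤n) (≤spread (<⇒≤ (≤-trans (odd-half< 2a+3<n) n≤m))))

  oddsLow-sameOrder : f 3 < f 1 → f 1 < f 0 → SameOrder n f (oddsBelow m)
  oddsLow-sameOrder f₃<f₁ f₁<f₀ = sameOrder-from-first-two f-inj (injectiveOn-≤ k n≤m (oddsBelow-injective m)) f-per
    (twoPeriodic-≤ (≤-trans n≤m (m≤n+m m 2)) (oddsBelow-periodic m)) (byParity n _ even-vs0 odd-vs0) (byParity n _ even-vs1 odd-vs1)
    where
    k = oddsBelow m
    even-vs0 : ∀ a → double a < n → (f (double a) < f 0 ⇔ k (double a) < k 0)
    even-vs0 a 2a<n rewrite oddsBelow-even m a = both-false (≤⇒≯ (f₀≤even a 2a<n)) (≤⇒≯ (m≤n+m (spread m) a))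
    odd-vs0 : ∀ a → suc (double a) < n → (f (suc (double a)) < f 0 ⇔ k (suc (double a)) < k 0)
    odd-vs0 a 2a+1<n rewrite oddsBelow-odd m a = both-true (≤-<-trans (odd≤f₁ f₃<f₁ a 2a+1<n) f₁<f₀) (odds-below-evens m a 0)
    even-vs1 : ∀ a → double a < n → (f (double a) < f 1 ⇔ k (double a) < k 1)
    even-vs1 a 2a<n rewrite oddsBelow-even m a =
      both-false (≤⇒≯ (≤-trans (<⇒≤ f₁<f₀) (f₀≤even a 2a<n))) (<-asym (odds-below-evens m 0 a))
    odd-vs1 : ∀ a → suc (double a) < n → (f (suc (double a)) < f 1 ⇔ k (suc (double a)) < k 1)
    odd-vs1 zero _ = both-false (<-irrefl refl) (<-irrefl refl)
    odd-vs1 (suc a) 2a+3<n rewrite oddsBelow-odd m (suc a) =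
      both-true (odds↓ f₃<f₁ 0 (suc a) (s≤s z≤n) 2a+3<n)
                (∸-monoʳ-< {spread m} {suc (suc a)} {1} (s≤s (s≤s z≤n)) (suc≤spread (<⇒≤ (≤-trans (odd-half< 2a+3<n) n≤m))))

  classify-core : Σ CoreShape λ c → ValidCore n c × SameOrder n f (coreKey n c)
  classify-core with <-cmp (f 1) (f 3) | <-cmp (f 0) (f 1)
  ... | tri≈ _ f₁≡f₃ _ | _ with () ← f-inj 1 3 1<n 3<n f₁≡f₃
  ... | _ | tri≈ _ f₀≡f₁ _ with () ← f-inj 0 1 0<n 1<n f₀≡f₁
  ... | tri< f₁<f₃ _ _ | tri< f₀<f₁ _ _ = let u , u<n , f~k = interleaving-low f₁<f₃ f₀<f₁ in inter u , u<n , f~k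
  ... | tri< f₁<f₃ _ _ | tri> _ _ f₁<f₀ = let u , u<n , f~k = interleaving-high f₁<f₃ f₁<f₀ in inter u , u<n , f~k
  ... | tri> _ _ f₃<f₁ | tri< f₀<f₁ _ _ = oddsHigh , tt , oddsHigh-sameOrder f₃<f₁ f₀<f₁
  ... | tri> _ _ f₃<f₁ | tri> _ _ f₁<f₀ = oddsLow , tt , oddsLow-sameOrder f₃<f₁ f₁<f₀

-- Every injective 2-periodic f on n ≥ 4 positions has one of the shapes:
-- if its evens decrease, its reversal has increasing evens.
classify : ∀ n f → 4 ≤ n → InjectiveOn n f → TwoPeriodic n f → Σ Shape λ p → Valid n p × SameOrder n f (key n p)
classify n f 4≤n f-inj f-per with <-cmp (f 0) (f 2)
... | tri≈ _ f₀≡f₂ _ with () ← f-inj 0 2 (4≤⇒0< 4≤n) (4≤⇒2< 4≤n) f₀≡f₂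
... | tri< f₀<f₂ _ _ = let c , valid , f~k = EvensIncreasing.classify-core n f 4≤n f-inj f-per f₀<f₂ in plain c , valid , f~k
... | tri> _ _ f₂<f₀ = reversed c , valid , reverse-sameOrder (m≤n+m n 2) rf~k
  where
  rf₀<rf₂ = from (reverse-order n f (4≤⇒0< 4≤n) (4≤⇒2< 4≤n)) f₂<f₀
  classified = EvensIncreasing.classify-core n (reverse n f) 4≤n (reverse-injective n f f-inj) (reverse-periodic n f f-per) rf₀<rf₂
  c = proj₁ classified
  valid = proj₁ (proj₂ classified)
  rf~k = proj₂ (proj₂ classified)

-- Soundness: the non-monotone shapes lie on 2-cycles.

-- The core shape underlying a shape; the monotone shapes are those with
-- core inter ⌊ n /2⌋.
core : Shape → CoreShape
core (plain c) = c
core (reversed c) = c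

coreKey-injective : ∀ n c → ValidCore n c → InjectiveOn (2 + n) (coreKey n c)
coreKey-injective n (inter u) _ = interleaving-injective ⌊ n /2⌋ u (2 + n)
coreKey-injective n oddsHigh _ = oddsAbove-injective (2 + n)
coreKey-injective n oddsLow _ = oddsBelow-injective (2 + n)

coreKey-periodic : ∀ n c → TwoPeriodic (2 + n) (coreKey n c)
coreKey-periodic n (inter u) = interleaving-periodic ⌊ n /2⌋ u (2 + n)
coreKey-periodic n oddsHigh = twoPeriodic-≤ (m≤n+m (2 + n) 2) (oddsAbove-periodic (2 + n))
coreKey-periodic n oddsLow = twoPeriodic-≤ (m≤n+m (2 + n) 2) (oddsBelow-periodic (2 + n))

-- interleaving h u zigzags unless u = h: for u > h position 1 lies above
-- positions 0 and 2, for u < h below both.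
interleaving-zigzag : ∀ h u → u ≢ h → Zigzag (interleaving h u)
interleaving-zigzag h u u≢h with <-cmp u h
... | tri≈ _ u≡h _ = ⊥-elim (u≢h u≡h)
... | tri< u<h _ _ = inj₂ (from (interleaving-oe h u 0 0) u<h , from (interleaving-oe h u 0 1) (m<n⇒m<1+n u<h))
... | tri> _ _ h<u = inj₁ (from (interleaving-eo h u 0 0) (<⇒≤ h<u) , from (interleaving-eo h u 1 0) h<u)

coreKey-zigzag : ∀ n c → c ≢ inter ⌊ n /2⌋ → Zigzag (coreKey n c)
coreKey-zigzag n (inter u) c≢id = interleaving-zigzag ⌊ n /2⌋ u (λ u≡h → c≢id (cong inter u≡h))
coreKey-zigzag n oddsHigh _ = inj₁ (s≤s z≤n , s≤s (s≤s z≤n))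
coreKey-zigzag n oddsLow _ = inj₂ (n<1+n _ , <-trans (n<1+n _) (n<1+n _))

key-injective : ∀ n p → Valid n p → InjectiveOn (2 + n) (key n p)
key-injective n (plain c) valid = coreKey-injective n c valid
key-injective n (reversed c) valid = reverse-injective (2 + n) (coreKey n c) (coreKey-injective n c valid)

key-periodic : ∀ n p → TwoPeriodic (2 + n) (key n p)
key-periodic n (plain c) = coreKey-periodic n c
key-periodic n (reversed c) = reverse-periodic (2 + n) (coreKey n c) (coreKey-periodic n c)

key-zigzag : ∀ n p → 1 ≤ n → core p ≢ inter ⌊ n /2⌋ → Zigzag (key n p)
key-zigzag n (plain c) _ c≢id = coreKey-zigzag n c c≢id
key-zigzag n (reversed c) 1≤n c≢id = reverse-zigzag (2 + n) (coreKey n c) (s≤s (s≤s 1≤n)) (coreKey-zigzag n c c≢id)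

shape-vertex-sound : ∀ n p → 2 ≤ n → Valid n p → core p ≢ inter ⌊ n /2⌋ →
  IsPerm n (st (key n p) n) × InTwoCycle n (st (key n p) n)
shape-vertex-sound n p 2≤n valid nonmonotone =
  st-isPerm (key n p) n (injectiveOn-≤ (key n p) (m≤n+m n 2) (key-injective n p valid)) ,
  twoCycle-of-key n (key n p) 2≤n (key-injective n p valid) (key-periodic n p)
    (key-zigzag n p (<-≤-trans (s≤s z≤n) 2≤n) nonmonotone)

-- Exclusion: the monotone shapes lie on no 2-cycle.

interleaving-identity : ∀ h i j → (interleaving h h i < interleaving h h j ⇔ i < j)
interleaving-identity h i j with evenOrOdd i | evenOrOdd j
... | inj₁ (a , refl) | inj₁ (b , refl) = interleaving-ee h h a b ⟫ ⇔-sym (double<double a b)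
... | inj₂ (a , refl) | inj₂ (b , refl) = interleaving-oo h h a b ⟫ ⇔-sym (odd<odd a b)
... | inj₁ (a , refl) | inj₂ (b , refl) =
  interleaving-eo h h a b ⟫ mk⇔ (+-cancelʳ-≤ h a b) (+-monoˡ-≤ h) ⟫ ⇔-sym (double<odd a b)
... | inj₂ (a , refl) | inj₁ (b , refl) = interleaving-oe h h a b ⟫ +-cancelʳ-<⇔ a b h ⟫ ⇔-sym (odd<double a b)

monotone-shape-excluded : ∀ n p {a b} → 4 ≤ n → core p ≡ inter ⌊ n /2⌋ → IsPerm n a → IsPerm n b →
  Edge n a b → Edge n b a → SameOrder n (at a) (key n p) → a ≡ b
monotone-shape-excluded (suc m) (plain _) 4≤n refl a-perm b-perm a→b b→a a~k =
  monotone-twoCycle-trivial m 2≤m a-perm b-perm a→b b→a _<_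
    suc-cancel-< (λ i<j j<i → <-asym i<j j<i) (inj₁ (s≤s z≤n , 2≤m , <-≤-trans (s≤s z≤n) 2≤m))
    (λ i j i<n j<n → a~k i j i<n j<n ⟫ interleaving-identity ⌊ suc m /2⌋ i j)
  where 2≤m = s≤s⁻¹ (4≤⇒2< 4≤n)
monotone-shape-excluded (suc m) (reversed _) 4≤n refl a-perm b-perm a→b b→a a~k =
  monotone-twoCycle-trivial m 2≤m a-perm b-perm a→b b→a (λ i j → j < i)
    (λ i j → suc-cancel-< j i) (λ i<j j<i → <-asym i<j j<i) (inj₂ (s≤s z≤n , 2≤m , <-≤-trans (s≤s z≤n) 2≤m))
    (λ i j i<n j<n → a~k i j i<n j<n
      ⟫ reverse-order (2 + suc m) (interleaving ⌊ suc m /2⌋ ⌊ suc m /2⌋) (m<n⇒m<1+n (m<n⇒m<1+n i<n)) (m<n⇒m<1+n (m<n⇒m<1+n j<n))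
      ⟫ interleaving-identity ⌊ suc m /2⌋ j i)
  where 2≤m = s≤s⁻¹ (4≤⇒2< 4≤n)

-- Distinctness: different valid shapes have different patterns.

opposite-comparison : ∀ {n k k'} → SameOrder n k k' → ∀ {i j} → i < n → j < n → k i < k j → k' j < k' i → ⊥
opposite-comparison k~k' i<n j<n kᵢ<kⱼ k'ⱼ<k'ᵢ = <-asym k'ⱼ<k'ᵢ (to (k~k' _ _ i<n j<n) kᵢ<kⱼ)

-- Different parameters give different interleavings: if h ≤ u < v, the
-- even position 2(v - h) lies below position 1 for v but not for u; if
-- u < h, the odd position 2(h - u - 1) + 1 lies below position 0 for u
-- but not for v.
interleaving-distinct : ∀ n u v → u < v → v < n → ¬ SameOrder n (interleaving ⌊ n /2⌋ u) (interleaving ⌊ n /2⌋ v)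
interleaving-distinct n u v u<v v<n ku~kv with ⌊ n /2⌋ ≤? u
... | yes h≤u = <⇒≱ u<v (subst (_≤ u) b+h≡v
        (to (interleaving-eo h u b 0) (from (ku~kv (double b) 1 2b<n 1<n) (from (interleaving-eo h v b 0) (≤-reflexive b+h≡v)))))
  where
  h = ⌊ n /2⌋
  b = v ∸ h
  b+h≡v : b + h ≡ v
  b+h≡v = m∸n+n≡m (≤-trans h≤u (<⇒≤ u<v))
  2b<n : double b < n
  2b<n = from (even<⇔ n b) (+-cancelʳ-< h b ⌈ n /2⌉
    (subst (b + h <_) (trans (sym (⌊n/2⌋+⌈n/2⌉≡n n)) (+-comm h ⌈ n /2⌉)) (subst (_< n) (sym b+h≡v) v<n)))
  1<n : 1 < n
  1<n = ≤-<-trans (≤-trans (s≤s z≤n) u<v) v<n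
... | no h≰u = <⇒≱ (to (interleaving-oe h v a 0) (to (ku~kv (suc (double a)) 0 2a+1<n 0<n) (from (interleaving-oe h u a 0) a+u<h)))
                   (subst (_≤ a + v) a+1+u≡h (+-monoʳ-≤ a u<v))
  where
  h = ⌊ n /2⌋
  u<h = ≰⇒> h≰u
  a = h ∸ suc u
  a+1+u≡h : a + suc u ≡ h
  a+1+u≡h = m∸n+n≡m u<h
  a+u<h : a + u < h
  a+u<h = subst (a + u <_) a+1+u≡h (+-monoʳ-< a (n<1+n u))
  2a+1<n : suc (double a) < n
  2a+1<n = from (odd<⇔ n a) (∸-monoʳ-< {h} {suc u} {0} (s≤s z≤n) u<h)
  0<n : 0 < n
  0<n = ≤-<-trans z≤n v<n

interleaving-param-unique : ∀ n u v → u < n → v < n →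
  SameOrder n (interleaving ⌊ n /2⌋ u) (interleaving ⌊ n /2⌋ v) → u ≡ v
interleaving-param-unique n u v u<n v<n ku~kv with <-cmp u v
... | tri< u<v _ _ = ⊥-elim (interleaving-distinct n u v u<v v<n ku~kv)
... | tri≈ _ u≡v _ = u≡v
... | tri> _ _ v<u = ⊥-elim (interleaving-distinct n v u v<u u<n (sameOrder-sym ku~kv))

coreKey-evens↑ : ∀ n c → coreKey n c 0 < coreKey n c 2
coreKey-evens↑ n (inter u) = from (interleaving-ee ⌊ n /2⌋ u 0 1) (s≤s z≤n)
coreKey-evens↑ n oddsHigh = s≤s z≤n
coreKey-evens↑ n oddsLow = n<1+n _

interleaving-odds↑ : ∀ h u → interleaving h u 1 < interleaving h u 3
interleaving-odds↑ h u = from (interleaving-oo h u 0 1) (s≤s z≤n)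

oddsHigh-odds↓ : ∀ n → coreKey n oddsHigh 3 < coreKey n oddsHigh 1
oddsHigh-odds↓ n = n<1+n _

oddsLow-odds↓ : ∀ n → coreKey n oddsLow 3 < coreKey n oddsLow 1
oddsLow-odds↓ n = n<1+n _

-- Shapes of the same kind: interleavings are told apart by their
-- parameter, from the other two by the odd positions 1, 3, and those two
-- from each other by positions 0, 1.
coreKey-distinct : ∀ n c c' → 4 ≤ n → ValidCore n c → ValidCore n c' →
  SameOrder n (coreKey n c) (coreKey n c') → c ≡ c'
coreKey-distinct n (inter u) (inter v) _ u<n v<n k~k' = cong inter (interleaving-param-unique n u v u<n v<n k~k')
coreKey-distinct n oddsHigh oddsHigh _ _ _ _ = refl
coreKey-distinct n oddsLow oddsLow _ _ _ _ = refl
coreKey-distinct n (inter u) oddsHigh 4≤n _ _ k~k' =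
  ⊥-elim (opposite-comparison k~k' (4≤⇒1< 4≤n) 4≤n (interleaving-odds↑ ⌊ n /2⌋ u) (oddsHigh-odds↓ n))
coreKey-distinct n (inter u) oddsLow 4≤n _ _ k~k' =
  ⊥-elim (opposite-comparison k~k' (4≤⇒1< 4≤n) 4≤n (interleaving-odds↑ ⌊ n /2⌋ u) (oddsLow-odds↓ n))
coreKey-distinct n oddsHigh (inter v) 4≤n _ _ k~k' =
  ⊥-elim (opposite-comparison k~k' 4≤n (4≤⇒1< 4≤n) (oddsHigh-odds↓ n) (interleaving-odds↑ ⌊ n /2⌋ v))
coreKey-distinct n oddsLow (inter v) 4≤n _ _ k~k' =
  ⊥-elim (opposite-comparison k~k' 4≤n (4≤⇒1< 4≤n) (oddsLow-odds↓ n) (interleaving-odds↑ ⌊ n /2⌋ v))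
coreKey-distinct n oddsHigh oddsLow 4≤n _ _ k~k' =
  ⊥-elim (opposite-comparison k~k' (4≤⇒0< 4≤n) (4≤⇒1< 4≤n) (s≤s z≤n) (n<1+n _))
coreKey-distinct n oddsLow oddsHigh 4≤n _ _ k~k' =
  ⊥-elim (opposite-comparison k~k' (4≤⇒1< 4≤n) (4≤⇒0< 4≤n) (n<1+n _) (s≤s z≤n))

reversed-evens↓ : ∀ n c → 1 ≤ n → key n (reversed c) 2 < key n (reversed c) 0
reversed-evens↓ n c 1≤n = from (reverse-order (2 + n) (coreKey n c) (s≤s (s≤s 1≤n)) (s≤s z≤n)) (coreKey-evens↑ n c)

-- A plain shape has increasing evens and a reversed one decreasing evens;
-- within each kind the core shapes are told apart.
key-distinct : ∀ n p q → 4 ≤ n → Valid n p → Valid n q → SameOrder n (key n p) (key n q) → p ≡ q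
key-distinct n (plain c) (plain c') 4≤n vc vc' k~k' = cong plain (coreKey-distinct n c c' 4≤n vc vc' k~k')
key-distinct n (reversed c) (reversed c') 4≤n vc vc' k~k' =
  cong reversed (coreKey-distinct n c c' 4≤n vc vc' (reverse-cancel (m≤n+m n 2) k~k'))
key-distinct n (plain c) (reversed c') 4≤n _ _ k~k' =
  ⊥-elim (opposite-comparison k~k' (4≤⇒0< 4≤n) (4≤⇒2< 4≤n) (coreKey-evens↑ n c) (reversed-evens↓ n c' (4≤⇒0< 4≤n)))
key-distinct n (reversed c) (plain c') 4≤n _ _ k~k' =
  ⊥-elim (opposite-comparison k~k' (4≤⇒2< 4≤n) (4≤⇒0< 4≤n) (reversed-evens↓ n c (4≤⇒0< 4≤n)) (coreKey-evens↑ n c'))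

st-≡⇒sameOrder : ∀ {n} k k' → st k n ≡ st k' n → SameOrder n k k'
st-≡⇒sameOrder {n} k k' st≡st =
  sameOrder-trans (sameOrder-sym (st-sameOrder k n)) (subst (λ v → SameOrder n (at v) k') (sym st≡st) (st-sameOrder k' n))

Admissible : ℕ → Shape → Set
Admissible n p = Valid n p × core p ≢ inter ⌊ n /2⌋

params : ℕ → List ℕ
params n = range 0 ⌊ n /2⌋ ++ range (suc ⌊ n /2⌋) (n ∸ suc ⌊ n /2⌋)

cores : ℕ → List CoreShape
cores n = map inter (params n) ++ oddsHigh ∷ oddsLow ∷ []

shapes : ℕ → List Shape
shapes n = map plain (cores n) ++ map reversed (cores n)

vertices : (n : ℕ) → List (Vec ℕ n)
vertices n = map (λ p → st (key n p) n) (shapes n)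

module Enumeration (m : ℕ) where
  -- Stated for n = m + 1, so that ⌊ n /2⌋ < n.
  n = suc m
  h = ⌊ n /2⌋

  h<n : h < n
  h<n = ⌊n/2⌋<n m

  h+1+rest≡n : suc h + (n ∸ suc h) ≡ n
  h+1+rest≡n = m+[n∸m]≡n h<n

  params-sound : ∀ {u} → u ∈ params n → u < n × u ≢ h
  params-sound {u} u∈ with ∈-++⁻ (range 0 h) u∈
  ... | inj₁ u∈low = let _ , u<h = ∈-range⁻ 0 h u∈low in <-trans u<h h<n , <⇒≢ u<h
  ... | inj₂ u∈high = let h<u , u<n = ∈-range⁻ (suc h) (n ∸ suc h) u∈high in
    subst (u <_) h+1+rest≡n u<n , (λ u≡h → <-irrefl (sym u≡h) h<u)

  params-complete : ∀ {u} → u < n → u ≢ h → u ∈ params n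
  params-complete {u} u<n u≢h with u <? h
  ... | yes u<h = ∈-++⁺ˡ (∈-range⁺ 0 h z≤n u<h)
  ... | no u≮h = ∈-++⁺ʳ (range 0 h)
    (∈-range⁺ (suc h) (n ∸ suc h) (≤∧≢⇒< (≮⇒≥ u≮h) (u≢h ∘′ sym)) (subst (u <_) (sym h+1+rest≡n) u<n))

  params-unique : Unique (params n)
  params-unique = Unique.++⁺ (range-unique 0 h) (range-unique (suc h) (n ∸ suc h))
    λ (u∈low , u∈high) → <-asym (proj₂ (∈-range⁻ 0 h u∈low)) (proj₁ (∈-range⁻ (suc h) (n ∸ suc h) u∈high))

  length-params : length (params n) ≡ m
  length-params = begin
    length (params n)                                   ≡⟨ length-++ (range 0 h) ⟩
    length (range 0 h) + length (range (suc h) (n ∸ suc h)) ≡⟨ cong₂ _+_ (length-range 0 h) (length-range (suc h) (n ∸ suc h)) ⟩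
    h + (n ∸ suc h)                                     ≡⟨ suc-injective h+1+rest≡n ⟩
    m                                                   ∎
    where open ≡-Reasoning

  cores-sound : ∀ {c} → c ∈ cores n → ValidCore n c × c ≢ inter h
  cores-sound c∈ with ∈-++⁻ (map inter (params n)) c∈
  ... | inj₁ c∈inter with ∈-map⁻ inter c∈inter
  ...   | u , u∈ , refl = proj₁ (params-sound u∈) , λ { refl → proj₂ (params-sound u∈) refl }
  cores-sound c∈ | inj₂ (here refl) = tt , λ ()
  cores-sound c∈ | inj₂ (there (here refl)) = tt , λ ()

  cores-complete : ∀ c → ValidCore n c → c ≢ inter h → c ∈ cores n
  cores-complete (inter u) u<n c≢id = ∈-++⁺ˡ (∈-map⁺ inter (params-complete u<n (λ u≡h → c≢id (cong inter u≡h))))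
  cores-complete oddsHigh _ _ = ∈-++⁺ʳ (map inter (params n)) (here refl)
  cores-complete oddsLow _ _ = ∈-++⁺ʳ (map inter (params n)) (there (here refl))

  cores-unique : Unique (cores n)
  cores-unique = Unique.++⁺ (Unique.map⁺ (λ { refl → refl }) params-unique) (((λ ()) ∷ []) ∷ [] ∷ [])
    λ (c∈inter , c∈rest) → inter≠ (proj₂ (proj₂ (∈-map⁻ inter c∈inter))) c∈rest
    where
    inter≠ : ∀ {c u} → c ≡ inter u → ¬ c ∈ (oddsHigh ∷ oddsLow ∷ [])
    inter≠ refl (here ())
    inter≠ refl (there (here ()))

  shapes-sound : ∀ {p} → p ∈ shapes n → Admissible n p
  shapes-sound p∈ with ∈-++⁻ (map plain (cores n)) p∈
  ... | inj₁ p∈plain with ∈-map⁻ plain p∈plain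
  ...   | c , c∈ , refl = cores-sound c∈
  shapes-sound p∈ | inj₂ p∈reversed with ∈-map⁻ reversed p∈reversed
  ...   | c , c∈ , refl = cores-sound c∈

  shapes-complete : ∀ p → Admissible n p → p ∈ shapes n
  shapes-complete (plain c) (valid , c≢id) = ∈-++⁺ˡ (∈-map⁺ plain (cores-complete c valid c≢id))
  shapes-complete (reversed c) (valid , c≢id) = ∈-++⁺ʳ (map plain (cores n)) (∈-map⁺ reversed (cores-complete c valid c≢id))

  shapes-unique : Unique (shapes n)
  shapes-unique = Unique.++⁺ (Unique.map⁺ (λ { refl → refl }) cores-unique) (Unique.map⁺ (λ { refl → refl }) cores-unique)
    λ (p∈plain , p∈reversed) →
      plain≢reversed (proj₂ (proj₂ (∈-map⁻ plain p∈plain))) (proj₂ (proj₂ (∈-map⁻ reversed p∈reversed)))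
    where
    plain≢reversed : ∀ {p c c'} → p ≡ plain c → p ≡ reversed c' → ⊥
    plain≢reversed refl ()

  length-shapes : length (shapes n) ≡ 2 * n + 2
  length-shapes = begin
    length (shapes n)                                     ≡⟨ length-++ (map plain (cores n)) ⟩
    length (map plain (cores n)) + length (map reversed (cores n))
                                                          ≡⟨ cong₂ _+_ (length-map plain (cores n)) (length-map reversed (cores n)) ⟩
    length (cores n) + length (cores n)                   ≡⟨ cong (λ ℓ → ℓ + ℓ) length-cores ⟩
    (m + 2) + (m + 2)                                     ≡⟨ count m ⟩
    2 * n + 2                                             ∎
    where
    open ≡-Reasoning
    count : ∀ m → (m + 2) + (m + 2) ≡ 2 * suc m + 2
    count = solve-∀
    length-cores : length (cores n) ≡ m + 2
    length-cores = trans (length-++ (map inter (params n))) (cong (_+ 2) (trans (length-map inter (params n)) length-params))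

  module _ (4≤n : 4 ≤ n) where

    vertices-unique : Unique (vertices n)
    vertices-unique = map-unique (λ p → st (key n p) n)
      (λ {p} {q} p∈ q∈ st≡st → key-distinct n p q 4≤n (proj₁ (shapes-sound p∈)) (proj₁ (shapes-sound q∈))
                                 (st-≡⇒sameOrder (key n p) (key n q) st≡st))
      shapes-unique

    vertex-sound : ∀ a → a ∈ vertices n → IsPerm n a × InTwoCycle n a
    vertex-sound a a∈ with ∈-map⁻ (λ p → st (key n p) n) a∈
    ... | p , p∈ , refl = shape-vertex-sound n p (4≤⇒1< 4≤n) (proj₁ (shapes-sound p∈)) (proj₂ (shapes-sound p∈))

    -- A vertex on a 2-cycle is 2-periodic, hence has a shape; it is the
    -- vertex of that shape, and the shape is not monotone as a ≠ b.
    vertex-complete : ∀ a → IsPerm n a × InTwoCycle n a → a ∈ vertices n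
    vertex-complete a (a-perm , b , b-perm , a≢b , a→b , b→a) =
      subst (_∈ vertices n) (sym a≡vertex) (∈-map⁺ (λ p → st (key n p) n) (shapes-complete p (valid , nonmonotone)))
      where
      classified = classify n (at a) 4≤n (perm-injective a-perm) (twoCycle-periodic a→b b→a)
      p = proj₁ classified
      valid = proj₁ (proj₂ classified)
      a~k = proj₂ (proj₂ classified)
      a≡vertex : a ≡ st (key n p) n
      a≡vertex = perm-unique a (st (key n p) n) a-perm
        (st-isPerm (key n p) n (injectiveOn-≤ (key n p) (m≤n+m n 2) (key-injective n p valid)))
        (sameOrder-trans a~k (sameOrder-sym (st-sameOrder (key n p) n)))
      nonmonotone : core p ≢ inter h
      nonmonotone core≡id = a≢b (monotone-shape-excluded n p 4≤n core≡id a-perm b-perm a→b b→a a~k)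

theorem4p1 : (n : ℕ) → 4 ≤ n →
    Σ (List (Vec ℕ n)) λ L →
    Unique L
    × (∀ (a : Vec ℕ n) → (a ∈ L) ⇔ (IsPerm n a × InTwoCycle n a))
    × length L ≡ 2 * n + 2
theorem4p1 (suc m) 4≤n =
  vertices n ,
  vertices-unique 4≤n ,
  (λ a → mk⇔ (vertex-sound 4≤n a) (vertex-complete 4≤n a)) ,
  trans (length-map (λ p → st (key n p) n) (shapes n)) length-shapes
  where open Enumeration m
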